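{- Let $m\geq 7$ and let $\mathfrak{X}=\{A_0,A_1,A_2\}$ be a non-symmetric class $2$ association scheme of order $m$ (so $A_0=I_m$ and $A_2=A_1^T$). Define the $(2m+1)\times(2m+1)$ matrix $B_1$ in block form, with row and column blocks of sizes $m,1,m$, by $$B_1=\begin{bmatrix} A_1 & \mathbf{0} & A_0+A_1\\ \mathbf{1}^T & 0 & \mathbf{0}^T\\ A_1 & \mathbf{1} & A_2\end{bmatrix},$$ where $\mathbf{0}$ and $\mathbf{1}$ denote the all-zero and all-one column vectors of length $m$. Set $B_0=I_{2m+1}$ and $B_2=B_1^T$. Then $\mathfrak{Y}=\{B_0,B_1,B_2\}$ is a non-symmetric class $2$ association scheme of order $2m+1$, the automorphism group $\operatorname{Aut}(\mathfrak{Y})$ is intransitive (so $\mathfrak{Y}$ is non-schurian), and $\operatorname{Aut}(\mathfrak{Y})$ is isomorphic to $\operatorname{Aut}(\mathfrak{X})$.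
   Context: An association scheme of order $m$ is a set $\{A_0,\dots,A_d\}$ of $m\times m$ $\{0,1\}$-matrices with $A_0=I_m$, $\sum_i A_i=J_m$ (all-ones matrix), each $A_i^T$ in the set, and each product $A_iA_j$ a linear combination of the $A_k$; $d$ is its class. It is non-symmetric if some $A_i^T\neq A_i$ ($i\ge1$). For a permutation $\sigma$ with permutation matrix $P_\sigma$, the automorphism group is $\operatorname{Aut}(\mathfrak{X})=\{\sigma\in S_m : P_\sigma^TA_iP_\sigma=A_i \text{ for all } i\}$. A scheme is schurian if it arises from a transitive permutation group $G$ on $\{1,\dots,m\}$ as the adjacency matrices of the orbits of $G$ on pairs $(x,y)$; a schurian scheme has transitive automorphism group. -}

module Defs where

open import Level using (Level)
open import Data.Nat using (ℕ; zero; suc; _+_; _*_)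
open import Data.Bool using (Bool; true; false; _∨_)
open import Data.Fin using (Fin; zero; suc; splitAt; _≟_)
open import Data.Fin.Permutation using (Permutation′; _⟨$⟩ʳ_; _∘ₚ_; id; flip; _≈_)
open import Data.Sum using (_⊎_; inj₁; inj₂)
open import Data.Product using (Σ; ∃; ∃-syntax; _×_; _,_; proj₁)
open import Relation.Nullary using (¬_)
open import Relation.Nullary.Decidable using (⌊_⌋)
open import Relation.Binary.PropositionalEquality using (_≡_; trans)
open import Function.Bundles using (_⇔_)

-- {0,1}-matrices of order m, entries as Bool (true = 1, false = 0).
Mat : ℕ → Set
Mat m = Fin m → Fin m → Bool

b2n : Bool → ℕ
b2n true  = 1
b2n false = 0

sumFin : (n : ℕ) → (Fin n → ℕ) → ℕ
sumFin zero    f = 0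
sumFin (suc n) f = f zero + sumFin n (λ k → f (suc k))

I : (m : ℕ) → Mat m
I m x y = ⌊ x ≟ y ⌋

transposeM : {m : ℕ} → Mat m → Mat m
transposeM A x y = A y x

prodEntry : {m : ℕ} → Mat m → Mat m → Fin m → Fin m → ℕ
prodEntry {m} A B x y = sumFin m (λ z → b2n (A x z) * b2n (B z y))

record IsAssocScheme (m d : ℕ) (A : Fin (suc d) → Mat m) : Set where
  field
    A₀≡I     : ∀ x y → A zero x y ≡ I m x y
    sum≡J    : ∀ x y → sumFin (suc d) (λ i → b2n (A i x y)) ≡ 1
    nonzero  : ∀ i → ∃[ x ] ∃[ y ] (A i x y ≡ true)
    transp   : ∀ i → ∃[ j ] (∀ x y → A j x y ≡ A i y x)
    -- each A_i A_j is a linear combination of the A_k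
    -- (coefficients may be taken in ℕ, since the A_k are disjoint 0/1 matrices)
    product  : ∀ i j → ∃ λ (c : Fin (suc d) → ℕ) → (∀ (x y : Fin m) →
                 prodEntry (A i) (A j) x y ≡ sumFin (suc d) (λ k → c k * b2n (A k x y)))

NonSymmetric : {m d : ℕ} → (Fin (suc d) → Mat m) → Set
NonSymmetric {m} {d} A = ∃[ i ] ¬ (∀ x y → A i x y ≡ A i y x)

-- σ ∈ Aut: P_σ^T A_i P_σ = A_i for all i, i.e. A_i(σx,σy) = A_i(x,y)
IsAut : {m d : ℕ} → (Fin (suc d) → Mat m) → Permutation′ m → Set
IsAut A σ = ∀ i x y → A i (σ ⟨$⟩ʳ x) (σ ⟨$⟩ʳ y) ≡ A i x y

Aut : {m d : ℕ} → (Fin (suc d) → Mat m) → Set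
Aut {m} A = Σ (Permutation′ m) (IsAut A)

_∘ᴬ_ : {m d : ℕ} {A : Fin (suc d) → Mat m} → Aut A → Aut A → Aut A
_∘ᴬ_ (σ , pσ) (τ , pτ) = (σ ∘ₚ τ) , λ i x y →
  trans (pτ i (σ ⟨$⟩ʳ x) (σ ⟨$⟩ʳ y)) (pσ i x y)

_≈ᴬ_ : {m d : ℕ} {A : Fin (suc d) → Mat m} → Aut A → Aut A → Set
σ ≈ᴬ τ = proj₁ σ ≈ proj₁ τ

record AutIso {m n d e : ℕ} (A : Fin (suc d) → Mat m) (B : Fin (suc e) → Mat n) : Set where
  field
    to       : Aut A → Aut B
    from     : Aut B → Aut A
    to-cong  : ∀ σ τ → σ ≈ᴬ τ → to σ ≈ᴬ to τ
    from-cong : ∀ σ τ → σ ≈ᴬ τ → from σ ≈ᴬ from τ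
    to-from  : ∀ τ → to (from τ) ≈ᴬ τ
    from-to  : ∀ σ → from (to σ) ≈ᴬ σ
    to-hom   : ∀ σ τ → to (σ ∘ᴬ τ) ≈ᴬ (to σ ∘ᴬ to τ)

AutTransitive : {m d : ℕ} → (Fin (suc d) → Mat m) → Set
AutTransitive {m} A = ∀ (x y : Fin m) → ∃[ σ ] (IsAut A σ × σ ⟨$⟩ʳ x ≡ y)

record SchurianWitness {m d : ℕ} (A : Fin (suc d) → Mat m)
                       (G : Permutation′ m → Set) : Set where
  field
    G-id     : G id
    G-comp   : ∀ σ τ → G σ → G τ → G (σ ∘ₚ τ)
    G-inv    : ∀ σ → G σ → G (flip σ)
    G-trans  : ∀ (x y : Fin m) → ∃[ σ ] (G σ × σ ⟨$⟩ʳ x ≡ y)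
    orbit    : ∀ i → ∃[ x ] ∃[ y ] (A i x y ≡ true ×
                 (∀ x′ y′ → (A i x′ y′ ≡ true) ⇔
                    (∃[ σ ] (G σ × σ ⟨$⟩ʳ x ≡ x′ × σ ⟨$⟩ʳ y ≡ y′))))

Schurian : {m d : ℕ} → (Fin (suc d) → Mat m) → Set₁
Schurian {m} A = ∃[ G ] SchurianWitness A G

-- The construction: points of Y are Fin (m + suc m) = blocks of sizes m, 1, m.
B₁ : {m : ℕ} → Mat m → Mat m → Mat (m + suc m)
B₁ {m} A₁ A₂ u v with splitAt m u | splitAt m v
... | inj₁ x | inj₁ y = A₁ x y
... | inj₁ x | inj₂ zero = false
... | inj₁ x | inj₂ (suc y) = I m x y ∨ A₁ x y
... | inj₂ zero | inj₁ y = true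
... | inj₂ zero | inj₂ zero = false
... | inj₂ zero | inj₂ (suc y) = false
... | inj₂ (suc x) | inj₁ y = A₁ x y
... | inj₂ (suc x) | inj₂ zero = true
... | inj₂ (suc x) | inj₂ (suc y) = A₂ x y

𝔜 : {m : ℕ} → (Fin 3 → Mat m) → Fin 3 → Mat (m + suc m)
𝔜 {m} A zero = I (m + suc m)
𝔜 {m} A (suc zero) = B₁ (A (suc zero)) (A (suc (suc zero)))
𝔜 {m} A (suc (suc zero)) = transposeM (B₁ (A (suc zero)) (A (suc (suc zero))))

-- A non-symmetric class 2 scheme {I, A₁, A₁ᵀ} is the same thing as a doubly regular
-- tournament: A₁ is a tournament with A₁² = s A₁ + (s + 1) A₁ᵀ, hence regular of valency
-- 2s + 1 and of order 4s + 3 (so s ≥ 1 when m ≥ 7). B₁ is again a tournament, and computing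
-- B₁² block by block shows that it is doubly regular with parameter 2s + 1, so 𝔜 is a scheme.
--
-- The apex ∞ (the middle point) is singled out by a local property: every in-neighbour w of
-- ∞ has a twin among the out-neighbours of ∞ (ι₂ x has the twin ι₁ x), i.e. one whose arcs
-- into the out-neighbourhood of ∞ are those of w; no other point has this property. So every
-- automorphism of 𝔜 fixes ∞, hence preserves both blocks and restricts to an automorphism of
-- 𝔛 on the first block, while automorphisms of 𝔛 extend blockwise. Fixing ∞ makes Aut(𝔜)
-- intransitive, whereas the group of a schurian scheme acts transitively.

module Submission where

open import Defs
open import Data.Bool using (Bool; true; false; _∨_)
open import Data.Bool.Properties using (∨-zeroʳ)
open import Data.Empty using (⊥)
open import Data.Fin using (Fin; zero; suc; _≟_; _↑ˡ_; _↑ʳ_; splitAt)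
open import Data.Fin.Permutation using (Permutation′; _⟨$⟩ʳ_; _⟨$⟩ˡ_; _∘ₚ_; flip; inverseˡ; inverseʳ; permutation)
open import Data.Fin.Properties using (suc-injective; splitAt-↑ˡ; splitAt-↑ʳ; join-splitAt; ↑ˡ-injective; ↑ʳ-injective)
open import Data.Nat using (ℕ; zero; suc; _+_; _*_; _≤_; _<_; z≤n; s≤s; >-nonZero)
open import Data.Nat.Properties hiding (_≟_; suc-injective)
open import Algebra.Properties.CommutativeSemigroup +-commutativeSemigroup using (interchange; xy∙z≈xz∙y)
open import Data.Nat.Tactic.RingSolver using (solve-∀)
open import Data.Product using (∃; ∃-syntax; _×_; _,_; proj₁; proj₂)
open import Data.Sum using (inj₁; inj₂; fromInj₁)
open import Data.Vec using (_∷_; []; lookup)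
open import Function using (_∘_)
open import Function.Bundles using (Equivalence)
open import Relation.Binary.PropositionalEquality
open import Relation.Nullary using (¬_; yes; no; contradiction)

-- Finite sums

sum-cong : ∀ n {f g : Fin n → ℕ} → (∀ i → f i ≡ g i) → sumFin n f ≡ sumFin n g
sum-cong zero    f≗g = refl
sum-cong (suc n) f≗g = cong₂ _+_ (f≗g zero) (sum-cong n (f≗g ∘ suc))

sum-zero : ∀ n → sumFin n (λ _ → 0) ≡ 0
sum-zero zero    = refl
sum-zero (suc n) = sum-zero n

sum-const : ∀ n c → sumFin n (λ _ → c) ≡ n * c
sum-const zero    c = refl
sum-const (suc n) c = cong (c +_) (sum-const n c)

sum-+ : ∀ n (f g : Fin n → ℕ) → sumFin n (λ i → f i + g i) ≡ sumFin n f + sumFin n g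
sum-+ zero    f g = refl
sum-+ (suc n) f g = trans (cong (f zero + g zero +_) (sum-+ n (f ∘ suc) (g ∘ suc)))
                          (interchange (f zero) (g zero) _ _)

sum-*ˡ : ∀ n c (f : Fin n → ℕ) → sumFin n (λ i → c * f i) ≡ c * sumFin n f
sum-*ˡ zero    c f = sym (*-zeroʳ c)
sum-*ˡ (suc n) c f = trans (cong (c * f zero +_) (sum-*ˡ n c (f ∘ suc)))
                           (sym (*-distribˡ-+ c (f zero) _))

sum-swap : ∀ n k (f : Fin n → Fin k → ℕ) →
           sumFin n (λ i → sumFin k (f i)) ≡ sumFin k (λ j → sumFin n (λ i → f i j))
sum-swap zero    k f = sym (sum-zero k)
sum-swap (suc n) k f = trans (cong (sumFin k (f zero) +_) (sum-swap n k (f ∘ suc)))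
                             (sym (sum-+ k (f zero) _))

sum-↑ : ∀ a b (f : Fin (a + b) → ℕ) →
        sumFin (a + b) f ≡ sumFin a (λ i → f (i ↑ˡ b)) + sumFin b (λ j → f (a ↑ʳ j))
sum-↑ zero    b f = refl
sum-↑ (suc a) b f = trans (cong (f zero +_) (sum-↑ a b (f ∘ suc))) (sym (+-assoc (f zero) _ _))

sum-mono-≤ : ∀ n {f g : Fin n → ℕ} → (∀ i → f i ≤ g i) → sumFin n f ≤ sumFin n g
sum-mono-≤ zero    f≤g = z≤n
sum-mono-≤ (suc n) f≤g = +-mono-≤ (f≤g zero) (sum-mono-≤ n (f≤g ∘ suc))

sum-mono-< : ∀ n {f g : Fin n → ℕ} → (∀ i → f i ≤ g i) → ∀ j → f j < g j → sumFin n f < sumFin n g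
sum-mono-< (suc n) f≤g zero    fj<gj = +-mono-<-≤ fj<gj (sum-mono-≤ n (f≤g ∘ suc))
sum-mono-< (suc n) f≤g (suc j) fj<gj = +-mono-≤-< (f≤g zero) (sum-mono-< n (f≤g ∘ suc) j fj<gj)

sum-pos⇒∃ : ∀ n (f : Fin n → ℕ) → 0 < sumFin n f → ∃[ i ] (0 < f i)
sum-pos⇒∃ (suc n) f pos with f zero in eq
... | suc _ = zero , subst (0 <_) (sym eq) (s≤s z≤n)
... | zero  with sum-pos⇒∃ n (f ∘ suc) pos
...   | i , fi>0 = suc i , fi>0

true≢false : ¬ true ≡ false
true≢false ()

≡-from-true : ∀ {b c} → (b ≡ true → c ≡ true) → (c ≡ true → b ≡ true) → b ≡ c
≡-from-true {true}          b⇒c _   = sym (b⇒c refl)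
≡-from-true {false} {true}  _   c⇒b = c⇒b refl
≡-from-true {false} {false} _   _   = refl

b2n-injective : ∀ {b c} → b2n b ≡ b2n c → b ≡ c
b2n-injective {true}  {true}  _ = refl
b2n-injective {false} {false} _ = refl

b2n-pos : ∀ {b} → 0 < b2n b → b ≡ true
b2n-pos {true} _ = refl

b2n-idem : ∀ b → b2n b * b2n b ≡ b2n b
b2n-idem true  = refl
b2n-idem false = refl

b2n*-cong : ∀ {b c b′ c′} → b ≡ b′ → c ≡ c′ → b2n b * b2n c ≡ b2n b′ * b2n c′
b2n*-cong = cong₂ (λ x y → b2n x * b2n y)

b2n-*-mono : ∀ {b c d} → (b ≡ true → c ≡ d) → b2n b * b2n d ≤ b2n c * b2n d
b2n-*-mono {false} _ = z≤n
b2n-*-mono {true} {c} {d} c≡d rewrite c≡d refl = ≤-reflexive (trans (*-identityˡ (b2n d)) (sym (b2n-idem d)))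

b2n-*-pos : ∀ {b c} → 0 < b2n b * b2n c → b ≡ true × c ≡ true
b2n-*-pos {true} {true} _ = refl , refl

I-refl : ∀ n (x : Fin n) → I n x x ≡ true
I-refl n x with x ≟ x
... | yes _   = refl
... | no x≢x = contradiction refl x≢x

I-≢ : ∀ n {x y : Fin n} → ¬ x ≡ y → I n x y ≡ false
I-≢ n {x} {y} x≢y with x ≟ y
... | yes x≡y = contradiction x≡y x≢y
... | no _    = refl

I⇒≡ : ∀ n {x y : Fin n} → I n x y ≡ true → x ≡ y
I⇒≡ n {x} {y} Ixy with x ≟ y
I⇒≡ n {x} {y} Ixy  | yes x≡y = x≡y
I⇒≡ n {x} {y} ()   | no _

I-sym : ∀ n (x y : Fin n) → I n x y ≡ I n y x
I-sym n x y with x ≟ y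
... | yes refl = sym (I-refl n x)
... | no x≢y   = sym (I-≢ n (x≢y ∘ sym))

I-injective : ∀ n k (f : Fin n → Fin k) → (∀ {x y} → f x ≡ f y → x ≡ y) →
              ∀ x y → I k (f x) (f y) ≡ I n x y
I-injective n k f f-inj x y with x ≟ y
... | yes refl = I-refl k (f x)
... | no x≢y   = I-≢ k (x≢y ∘ f-inj)

sum-Iʳ : ∀ n (f : Fin n → ℕ) v → sumFin n (λ z → f z * b2n (I n z v)) ≡ f v
sum-Iʳ (suc n) f zero = begin
  f zero * 1 + sumFin n (λ z → f (suc z) * b2n (I (suc n) (suc z) zero))
    ≡⟨ cong₂ _+_ (*-identityʳ (f zero))
                 (sum-cong n (λ z → cong (λ b → f (suc z) * b2n b) (I-≢ (suc n) {suc z} {zero} λ ()))) ⟩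
  f zero + sumFin n (λ z → f (suc z) * 0)
    ≡⟨ cong (f zero +_) (trans (sum-cong n (*-zeroʳ ∘ f ∘ suc)) (sum-zero n)) ⟩
  f zero + 0
    ≡⟨ +-identityʳ (f zero) ⟩
  f zero ∎
  where open ≡-Reasoning
sum-Iʳ (suc n) f (suc v) = begin
  f zero * b2n (I (suc n) zero (suc v)) + sumFin n (λ z → f (suc z) * b2n (I (suc n) (suc z) (suc v)))
    ≡⟨ cong₂ _+_ (cong (λ b → f zero * b2n b) (I-≢ (suc n) {zero} {suc v} λ ()))
                 (sum-cong n (λ z → cong (λ b → f (suc z) * b2n b) (I-injective n (suc n) suc suc-injective z v))) ⟩
  f zero * 0 + sumFin n (λ z → f (suc z) * b2n (I n z v))
    ≡⟨ cong₂ _+_ (*-zeroʳ (f zero)) (sum-Iʳ n (f ∘ suc) v) ⟩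
  f (suc v) ∎
  where open ≡-Reasoning

sum-Iˡ : ∀ n (f : Fin n → ℕ) u → sumFin n (λ z → b2n (I n u z) * f z) ≡ f u
sum-Iˡ n f u = trans (sum-cong n λ z → trans (*-comm (b2n (I n u z)) (f z))
                                             (cong (λ b → f z * b2n b) (I-sym n u z)))
                     (sum-Iʳ n f u)

-- Tournaments

data Trichotomy (d p q : Bool) : Set where
  diagonal : d ≡ true  → p ≡ false → q ≡ false → Trichotomy d p q
  forward  : d ≡ false → p ≡ true  → q ≡ false → Trichotomy d p q
  backward : d ≡ false → p ≡ false → q ≡ true  → Trichotomy d p q

trichotomy : ∀ d p q → b2n d + b2n p + b2n q ≡ 1 → Trichotomy d p q
trichotomy true  false false _ = diagonal refl refl refl
trichotomy false true  false _ = forward  refl refl refl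
trichotomy false false true  _ = backward refl refl refl
trichotomy true  true  _     ()
trichotomy true  false true  ()
trichotomy false true  true  ()
trichotomy false false false ()

b2n-∨-disjoint : ∀ d p q → b2n d + b2n p + b2n q ≡ 1 → b2n (d ∨ p) ≡ b2n d + b2n p
b2n-∨-disjoint d p q one with trichotomy d p q one
... | diagonal refl refl _ = refl
... | forward  refl refl _ = refl
... | backward refl refl _ = refl

IsTournament : {n : ℕ} → Mat n → Set
IsTournament {n} T = ∀ u v → b2n (I n u v) + b2n (T u v) + b2n (T v u) ≡ 1

outdeg : {n : ℕ} → Mat n → Fin n → ℕ
outdeg {n} T u = sumFin n (λ z → b2n (T u z))

indeg : {n : ℕ} → Mat n → Fin n → ℕ
indeg {n} T v = sumFin n (λ z → b2n (T z v))

module Tournament {n : ℕ} {T : Mat n} (tour : IsTournament T) where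

  trichotomyAt : ∀ u v → Trichotomy (I n u v) (T u v) (T v u)
  trichotomyAt u v = trichotomy _ _ _ (tour u v)

  irreflexive : ∀ u → T u u ≡ false
  irreflexive u with trichotomyAt u u
  ... | diagonal _ Tuu _ = Tuu
  ... | forward  Iuu _ _ = contradiction (trans (sym (I-refl n u)) Iuu) true≢false
  ... | backward Iuu _ _ = contradiction (trans (sym (I-refl n u)) Iuu) true≢false

  asymmetric : ∀ {u v} → T u v ≡ true → T v u ≡ false
  asymmetric {u} {v} Tuv with trichotomyAt u v
  ... | diagonal _ Tuv′ _ = contradiction (trans (sym Tuv) Tuv′) true≢false
  ... | forward  _ _ Tvu  = Tvu
  ... | backward _ Tuv′ _ = contradiction (trans (sym Tuv) Tuv′) true≢false

  arc⇒≢ : ∀ {u v} → T u v ≡ true → ¬ u ≡ v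
  arc⇒≢ {u} Tuv refl = true≢false (trans (sym Tuv) (irreflexive u))

  ≢∧¬arc⇒arc : ∀ {u v} → ¬ u ≡ v → T u v ≡ false → T v u ≡ true
  ≢∧¬arc⇒arc {u} {v} u≢v ¬Tuv with trichotomyAt u v
  ... | diagonal Iuv _ _ = contradiction (I⇒≡ n Iuv) u≢v
  ... | forward  _ Tuv _ = contradiction (trans (sym Tuv) ¬Tuv) true≢false
  ... | backward _ _ Tvu = Tvu

  row-injective : ∀ {u v} → (∀ z → T u z ≡ T v z) → u ≡ v
  row-injective {u} {v} rows with trichotomyAt u v
  ... | diagonal Iuv _ _ = I⇒≡ n Iuv
  ... | forward  _ Tuv _ = contradiction (trans (sym Tuv) (trans (rows v) (irreflexive v))) true≢false
  ... | backward _ _ Tvu = contradiction (trans (sym Tvu) (trans (sym (rows u)) (irreflexive u))) true≢false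

  arcs-differ : ∀ {u v} → ¬ u ≡ v → ¬ T u v ≡ T v u
  arcs-differ {u} {v} u≢v Tuv≡Tvu with trichotomyAt u v
  ... | diagonal Iuv _ _   = u≢v (I⇒≡ n Iuv)
  ... | forward  _ Tuv Tvu = true≢false (trans (sym Tuv) (trans Tuv≡Tvu Tvu))
  ... | backward _ Tuv Tvu = true≢false (trans (sym Tvu) (trans (sym Tuv≡Tvu) Tuv))

  b2n-I∨T : ∀ u v → b2n (I n u v ∨ T u v) ≡ b2n (I n u v) + b2n (T u v)
  b2n-I∨T u v = b2n-∨-disjoint (I n u v) (T u v) (T v u) (tour u v)

  sum-I∨Tˡ : ∀ u (f : Fin n → ℕ) →
             sumFin n (λ z → b2n (I n u z ∨ T u z) * f z) ≡ f u + sumFin n (λ z → b2n (T u z) * f z)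
  sum-I∨Tˡ u f = begin
    sumFin n (λ z → b2n (I n u z ∨ T u z) * f z)
      ≡⟨ sum-cong n (λ z → trans (cong (_* f z) (b2n-I∨T u z)) (*-distribʳ-+ (f z) (b2n (I n u z)) (b2n (T u z)))) ⟩
    sumFin n (λ z → b2n (I n u z) * f z + b2n (T u z) * f z)
      ≡⟨ sum-+ n _ _ ⟩
    sumFin n (λ z → b2n (I n u z) * f z) + sumFin n (λ z → b2n (T u z) * f z)
      ≡⟨ cong (_+ sumFin n (λ z → b2n (T u z) * f z)) (sum-Iˡ n f u) ⟩
    f u + sumFin n (λ z → b2n (T u z) * f z) ∎
    where open ≡-Reasoning

  sum-I∨Tʳ : ∀ v (f : Fin n → ℕ) →
             sumFin n (λ z → f z * b2n (I n z v ∨ T z v)) ≡ f v + sumFin n (λ z → f z * b2n (T z v))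
  sum-I∨Tʳ v f = begin
    sumFin n (λ z → f z * b2n (I n z v ∨ T z v))
      ≡⟨ sum-cong n (λ z → trans (cong (f z *_) (b2n-I∨T z v)) (*-distribˡ-+ (f z) (b2n (I n z v)) (b2n (T z v)))) ⟩
    sumFin n (λ z → f z * b2n (I n z v) + f z * b2n (T z v))
      ≡⟨ sum-+ n _ _ ⟩
    sumFin n (λ z → f z * b2n (I n z v)) + sumFin n (λ z → f z * b2n (T z v))
      ≡⟨ cong (_+ sumFin n (λ z → f z * b2n (T z v))) (sum-Iʳ n f v) ⟩
    f v + sumFin n (λ z → f z * b2n (T z v)) ∎
    where open ≡-Reasoning

  sum-I∨T-row : ∀ u → sumFin n (λ z → b2n (I n u z ∨ T u z)) ≡ suc (outdeg T u)
  sum-I∨T-row u = trans (sum-cong n (λ z → sym (*-identityʳ (b2n (I n u z ∨ T u z)))))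
                        (trans (sum-I∨Tˡ u (λ _ → 1)) (cong suc (sum-cong n (*-identityʳ ∘ b2n ∘ T u))))

  sum-I∨T-column : ∀ v → sumFin n (λ z → b2n (I n z v ∨ T z v)) ≡ suc (indeg T v)
  sum-I∨T-column v = trans (sum-cong n (λ z → sym (*-identityˡ (b2n (I n z v ∨ T z v)))))
                           (trans (sum-I∨Tʳ v (λ _ → 1)) (cong suc (sum-cong n λ z → *-identityˡ (b2n (T z v)))))

  sum-split-at : ∀ u (f : Fin n → ℕ) →
                 sumFin n f ≡ f u + sumFin n (λ z → b2n (T u z) * f z) + sumFin n (λ z → b2n (T z u) * f z)
  sum-split-at u f = begin
    sumFin n f
      ≡⟨ sum-cong n (λ z → sym (trans (cong (_* f z) (tour u z)) (*-identityˡ (f z)))) ⟩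
    sumFin n (λ z → (b2n (I n u z) + b2n (T u z) + b2n (T z u)) * f z)
      ≡⟨ sum-cong n (λ z → distrib3 (b2n (I n u z)) (b2n (T u z)) (b2n (T z u)) (f z)) ⟩
    sumFin n (λ z → b2n (I n u z) * f z + b2n (T u z) * f z + b2n (T z u) * f z)
      ≡⟨ trans (sum-+ n _ _) (cong (_+ sumFin n (λ z → b2n (T z u) * f z)) (sum-+ n _ _)) ⟩
    sumFin n (λ z → b2n (I n u z) * f z) + sumFin n (λ z → b2n (T u z) * f z) + sumFin n (λ z → b2n (T z u) * f z)
      ≡⟨ cong (λ x → x + sumFin n (λ z → b2n (T u z) * f z) + sumFin n (λ z → b2n (T z u) * f z)) (sum-Iˡ n f u) ⟩
    f u + sumFin n (λ z → b2n (T u z) * f z) + sumFin n (λ z → b2n (T z u) * f z) ∎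
    where
    open ≡-Reasoning
    distrib3 : ∀ a b c x → (a + b + c) * x ≡ a * x + b * x + c * x
    distrib3 = solve-∀

  outdeg-decomposition : ∀ u v →
    b2n (T u v) + prodEntry T T u v + prodEntry T (transposeM T) u v ≡ outdeg T u
  outdeg-decomposition u v = begin
    b2n (T u v) + prodEntry T T u v + prodEntry T (transposeM T) u v
      ≡⟨ xy∙z≈xz∙y (b2n (T u v)) _ _ ⟩
    b2n (T u v) + prodEntry T (transposeM T) u v + prodEntry T T u v
      ≡⟨ cong₂ (λ x y → b2n (T u v) + x + y) (sum-cong n λ z → *-comm (b2n (T u z)) _)
                                              (sum-cong n λ z → *-comm (b2n (T u z)) _) ⟩
    b2n (T u v) + sumFin n (λ z → b2n (T v z) * b2n (T u z)) + sumFin n (λ z → b2n (T z v) * b2n (T u z))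
      ≡⟨ sym (sum-split-at v (λ z → b2n (T u z))) ⟩
    outdeg T u ∎
    where open ≡-Reasoning

  indeg-decomposition : ∀ u v →
    b2n (T u v) + prodEntry T T u v + prodEntry (transposeM T) T u v ≡ indeg T v
  indeg-decomposition u v = sym (sum-split-at u (λ z → b2n (T z v)))

  square-diagonal : ∀ u → prodEntry T T u u ≡ 0
  square-diagonal u = trans (sum-cong n no-2-cycle) (sum-zero n)
    where
    no-2-cycle : ∀ z → b2n (T u z) * b2n (T z u) ≡ 0
    no-2-cycle z with trichotomyAt u z
    ... | diagonal _ Tuz _ rewrite Tuz = refl
    ... | forward  _ _ Tzu rewrite Tzu = *-zeroʳ (b2n (T u z))
    ... | backward _ Tuz _ rewrite Tuz = refl

  order-decomposition : ∀ u → n ≡ suc (outdeg T u + indeg T u)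
  order-decomposition u = begin
    n                                    ≡⟨ sym (trans (sum-const n 1) (*-identityʳ n)) ⟩
    sumFin n (λ _ → 1)                   ≡⟨ sum-split-at u (λ _ → 1) ⟩
    1 + sumFin n (λ z → b2n (T u z) * 1) + sumFin n (λ z → b2n (T z u) * 1)
      ≡⟨ cong₂ (λ x y → 1 + x + y) (sum-cong n (*-identityʳ ∘ b2n ∘ T u))
                                    (sum-cong n (λ z → *-identityʳ (b2n (T z u)))) ⟩
    suc (outdeg T u + indeg T u) ∎
    where open ≡-Reasoning

-- Doubly regular tournaments

record IsDoublyRegular {n : ℕ} (T : Mat n) (s : ℕ) : Set where
  field
    tournament : IsTournament T
    outdeg≡    : ∀ u → outdeg T u ≡ s + suc s
    indeg≡     : ∀ v → indeg T v ≡ s + suc s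
    square≡    : ∀ u v → prodEntry T T u v ≡ s * b2n (T u v) + suc s * b2n (T v u)

tournamentScheme : {n : ℕ} → Mat n → Fin 3 → Mat n
tournamentScheme {n} T zero             = I n
tournamentScheme     T (suc zero)       = T
tournamentScheme     T (suc (suc zero)) = transposeM T

cancel-trichotomy : ∀ s d p q c → d + p + q ≡ 1 →
  p + (s * p + suc s * q) + c ≡ s + suc s → c ≡ (s + suc s) * d + s * p + s * q
cancel-trichotomy s d p q c one total = +-cancelˡ-≡ (p + (s * p + suc s * q)) c _ (begin
  p + (s * p + suc s * q) + c          ≡⟨ total ⟩
  s + suc s                            ≡⟨ sym (*-identityʳ (s + suc s)) ⟩
  (s + suc s) * 1                      ≡⟨ cong ((s + suc s) *_) (sym one) ⟩
  (s + suc s) * (d + p + q)            ≡⟨ expand s d p q ⟩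
  p + (s * p + suc s * q) + ((s + suc s) * d + s * p + s * q) ∎)
  where
  open ≡-Reasoning
  expand : ∀ s d p q → (s + suc s) * (d + p + q) ≡ p + (s * p + suc s * q) + ((s + suc s) * d + s * p + s * q)
  expand = solve-∀

-- The right-hand side is sumFin 3 unfolded.
combination : ∀ a b c x y z → a * x + b * y + c * z ≡ a * x + (b * y + (c * z + 0))
combination = solve-∀

module DoublyRegular {n : ℕ} {T : Mat n} {s : ℕ} (dr : IsDoublyRegular T s) where
  open IsDoublyRegular dr public
  open Tournament tournament public

  TTᵀ≡ : ∀ u v → prodEntry T (transposeM T) u v ≡
                 (s + suc s) * b2n (I n u v) + s * b2n (T u v) + s * b2n (T v u)
  TTᵀ≡ u v = cancel-trichotomy s _ _ _ _ (tournament u v)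
    (trans (cong (λ P → b2n (T u v) + P + prodEntry T (transposeM T) u v) (sym (square≡ u v)))
           (trans (outdeg-decomposition u v) (outdeg≡ u)))

  TᵀT≡ : ∀ u v → prodEntry (transposeM T) T u v ≡
                 (s + suc s) * b2n (I n u v) + s * b2n (T u v) + s * b2n (T v u)
  TᵀT≡ u v = cancel-trichotomy s _ _ _ _ (tournament u v)
    (trans (cong (λ P → b2n (T u v) + P + prodEntry (transposeM T) T u v) (sym (square≡ u v)))
           (trans (indeg-decomposition u v) (indeg≡ v)))

  order≡ : Fin n → n ≡ suc ((s + suc s) + (s + suc s))
  order≡ u = trans (order-decomposition u) (cong₂ (λ x y → suc (x + y)) (outdeg≡ u) (indeg≡ u))

  7≤order⇒1≤s : Fin n → 7 ≤ n → 1 ≤ s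
  7≤order⇒1≤s u = bound s (order≡ u)
    where
    bound : ∀ s → n ≡ suc ((s + suc s) + (s + suc s)) → 7 ≤ n → 1 ≤ s
    bound zero    refl (s≤s (s≤s (s≤s ())))
    bound (suc _) _    _ = s≤s z≤n

  valency>0 : 0 < s + suc s
  valency>0 = ≤-trans (s≤s z≤n) (m≤n+m (suc s) s)

  out-neighbour : ∀ u → ∃[ v ] (T u v ≡ true)
  out-neighbour u with sum-pos⇒∃ n (λ z → b2n (T u z)) (subst (0 <_) (sym (outdeg≡ u)) valency>0)
  ... | v , pos = v , b2n-pos pos

  in-neighbour : ∀ v → ∃[ u ] (T u v ≡ true)
  in-neighbour v with sum-pos⇒∃ n (λ z → b2n (T z v)) (subst (0 <_) (sym (indeg≡ v)) valency>0)
  ... | u , pos = u , b2n-pos pos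

  two-path : 1 ≤ s → ∀ {u v} → T u v ≡ true → ∃[ w ] (T u w ≡ true × T w v ≡ true)
  two-path 1≤s {u} {v} Tuv with sum-pos⇒∃ n _ (subst (0 <_) (sym (square≡ u v)) positive)
    where
    positive : 0 < s * b2n (T u v) + suc s * b2n (T v u)
    positive rewrite Tuv | asymmetric Tuv | *-identityʳ s | *-zeroʳ (suc s) | +-identityʳ s = 1≤s
  ... | w , pos = w , b2n-*-pos pos

  TTᵀ-sym : ∀ u v → prodEntry T (transposeM T) u v ≡ prodEntry T (transposeM T) v u
  TTᵀ-sym u v = sum-cong n λ z → *-comm (b2n (T u z)) (b2n (T v z))

  TTᵀ-arc : ∀ {u v} → T u v ≡ true → prodEntry T (transposeM T) u v ≡ s
  TTᵀ-arc {u} {v} Tuv rewrite TTᵀ≡ u v | I-≢ n (arc⇒≢ Tuv) | Tuv | asymmetric Tuv = middle (s + suc s) s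
    where
    middle : ∀ k s → k * 0 + s * 1 + s * 0 ≡ s
    middle = solve-∀

  -- y → x → z with y and z alike on the arcs out of and into x is impossible: the common
  -- out-neighbours of x and z are common out-neighbours of y and z, and a 2-path y → w₀ → x
  -- adds one more, whereas both pairs are arcs and so have exactly s of them.
  same-arcs-around-arc : 1 ≤ s → ∀ {x y z} → T y x ≡ true → T x z ≡ true →
    (∀ q → T x q ≡ true → T y q ≡ T z q) → (∀ q → T q x ≡ true → T q y ≡ T q z) → ⊥
  same-arcs-around-arc 1≤s {x} {y} {z} Tyx Txz agree-out agree-in with two-path 1≤s Tyx
  ... | w₀ , Tyw₀ , Tw₀x = <-irrefl (trans (TTᵀ-arc Txz) (sym (trans (TTᵀ-sym y z) (TTᵀ-arc Tzy)))) more-common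
    where
    Tzy : T z y ≡ true
    Tzy = ≢∧¬arc⇒arc y≢z (trans (sym (agree-in y Tyx)) (irreflexive y))
      where
      y≢z : ¬ y ≡ z
      y≢z refl = true≢false (trans (sym Txz) (asymmetric Tyx))

    Tzw₀ : T z w₀ ≡ true
    Tzw₀ = ≢∧¬arc⇒arc w₀≢z (trans (sym (agree-in w₀ Tw₀x)) (asymmetric Tyw₀))
      where
      w₀≢z : ¬ w₀ ≡ z
      w₀≢z refl = true≢false (trans (sym Txz) (asymmetric Tw₀x))

    more-common : prodEntry T (transposeM T) x z < prodEntry T (transposeM T) y z
    more-common = sum-mono-< n (λ q → b2n-*-mono (agree-out q)) w₀ strict
      where
      strict : b2n (T x w₀) * b2n (T z w₀) < b2n (T y w₀) * b2n (T z w₀)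
      strict rewrite asymmetric Tw₀x | Tyw₀ | Tzw₀ = s≤s z≤n

  isAssocScheme : Fin n → IsAssocScheme n 2 (tournamentScheme T)
  isAssocScheme x₀ = record
    { A₀≡I    = λ _ _ → refl
    ; sum≡J   = λ u v → trans (cong (λ x → b2n (I n u v) + (b2n (T u v) + x)) (+-identityʳ (b2n (T v u))))
                              (trans (sym (+-assoc (b2n (I n u v)) _ _)) (tournament u v))
    ; nonzero = nonzero
    ; transp  = transp
    ; product = product
    }
    where
    nonzero : ∀ i → ∃[ x ] ∃[ y ] (tournamentScheme T i x y ≡ true)
    nonzero zero             = x₀ , x₀ , I-refl n x₀
    nonzero (suc zero)       = x₀ , out-neighbour x₀
    nonzero (suc (suc zero)) = proj₁ (out-neighbour x₀) , x₀ , proj₂ (out-neighbour x₀)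

    transp : ∀ i → ∃[ j ] (∀ x y → tournamentScheme T j x y ≡ tournamentScheme T i y x)
    transp zero             = zero , I-sym n
    transp (suc zero)       = suc (suc zero) , λ _ _ → refl
    transp (suc (suc zero)) = suc zero , λ _ _ → refl

    combine : ∀ c₀ c₁ c₂ x y → c₀ * b2n (I n x y) + c₁ * b2n (T x y) + c₂ * b2n (T y x) ≡
              sumFin 3 (λ l → lookup (c₀ ∷ c₁ ∷ c₂ ∷ []) l * b2n (tournamentScheme T l x y))
    combine c₀ c₁ c₂ x y = combination c₀ c₁ c₂ (b2n (I n x y)) (b2n (T x y)) (b2n (T y x))

    product : ∀ i j → ∃ λ (c : Fin 3 → ℕ) → ∀ x y →
      prodEntry (tournamentScheme T i) (tournamentScheme T j) x y ≡
      sumFin 3 (λ l → c l * b2n (tournamentScheme T l x y))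
    product zero j = (λ l → b2n (I 3 j l)) , λ x y →
      trans (sum-Iˡ n (λ z → b2n (tournamentScheme T j z y)) x)
            (sym (sum-Iˡ 3 (λ l → b2n (tournamentScheme T l x y)) j))
    product i@(suc _) zero = (λ l → b2n (I 3 i l)) , λ x y →
      trans (sum-Iʳ n (λ z → b2n (tournamentScheme T i x z)) y)
            (sym (sum-Iˡ 3 (λ l → b2n (tournamentScheme T l x y)) i))
    product (suc zero) (suc zero) = lookup (0 ∷ s ∷ suc s ∷ []) , λ x y →
      trans (square≡ x y) (combine 0 s (suc s) x y)
    product (suc zero) (suc (suc zero)) = lookup (s + suc s ∷ s ∷ s ∷ []) , λ x y →
      trans (TTᵀ≡ x y) (combine (s + suc s) s s x y)
    product (suc (suc zero)) (suc zero) = lookup (s + suc s ∷ s ∷ s ∷ []) , λ x y →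
      trans (TᵀT≡ x y) (combine (s + suc s) s s x y)
    product (suc (suc zero)) (suc (suc zero)) = lookup (0 ∷ suc s ∷ s ∷ []) , λ x y →
      trans (sum-cong n (λ z → *-comm (b2n (T z x)) (b2n (T y z))))
            (trans (square≡ y x) (trans (+-comm (s * b2n (T y x)) _) (combine 0 (suc s) s x y)))

-- Non-symmetric class 2 schemes

IsAssocScheme-resp : ∀ {m d} {A A′ : Fin (suc d) → Mat m} → (∀ i x y → A i x y ≡ A′ i x y) →
                     IsAssocScheme m d A → IsAssocScheme m d A′
IsAssocScheme-resp {m} {d} {A} {A′} A≗A′ S = record
  { A₀≡I    = λ x y → trans (sym (A≗A′ zero x y)) (A₀≡I x y)
  ; sum≡J   = λ x y → trans (sum-cong (suc d) λ i → cong b2n (sym (A≗A′ i x y))) (sum≡J x y)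
  ; nonzero = λ i → let x , y , Aixy = nonzero i in x , y , trans (sym (A≗A′ i x y)) Aixy
  ; transp  = λ i → let j , Aj≡Aiᵀ = transp i in
                    j , λ x y → trans (sym (A≗A′ j x y)) (trans (Aj≡Aiᵀ x y) (A≗A′ i y x))
  ; product = λ i j → let c , AiAj≡ = product i j in c , λ x y →
      trans (sum-cong m λ z → b2n*-cong (sym (A≗A′ i x z)) (sym (A≗A′ j z y)))
            (trans (AiAj≡ x y) (sum-cong (suc d) λ k → cong (λ b → c k * b2n b) (A≗A′ k x y)))
  }
  where open IsAssocScheme S

module ClassTwo {m : ℕ} {A : Fin 3 → Mat m} (S : IsAssocScheme m 2 A) (nonSym : NonSymmetric A) where
  open IsAssocScheme S

  A₁ A₂ : Mat m
  A₁ = A (suc zero)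
  A₂ = A (suc (suc zero))

  x₀ : Fin m
  x₀ = proj₁ (nonzero zero)

  partition : ∀ x y → b2n (I m x y) + b2n (A₁ x y) + b2n (A₂ x y) ≡ 1
  partition x y = begin
    b2n (I m x y) + b2n (A₁ x y) + b2n (A₂ x y)
      ≡⟨ cong (λ b → b2n b + b2n (A₁ x y) + b2n (A₂ x y)) (sym (A₀≡I x y)) ⟩
    b2n (A zero x y) + b2n (A₁ x y) + b2n (A₂ x y)
      ≡⟨ +-assoc (b2n (A zero x y)) _ _ ⟩
    b2n (A zero x y) + (b2n (A₁ x y) + b2n (A₂ x y))
      ≡⟨ cong (λ k → b2n (A zero x y) + (b2n (A₁ x y) + k)) (sym (+-identityʳ (b2n (A₂ x y)))) ⟩
    sumFin 3 (λ i → b2n (A i x y))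
      ≡⟨ sum≡J x y ⟩
    1 ∎
    where open ≡-Reasoning

  A₁-irreflexive : ∀ x → A₁ x x ≡ false
  A₁-irreflexive x with trichotomy _ _ _ (partition x x)
  ... | diagonal _ A₁xx _ = A₁xx
  ... | forward  Ixx _ _  = contradiction (trans (sym (I-refl m x)) Ixx) true≢false
  ... | backward Ixx _ _  = contradiction (trans (sym (I-refl m x)) Ixx) true≢false

  -- If A₁ were its own transpose, so would be A₂ (its complement off the diagonal),
  -- and the scheme would be symmetric.
  A₂≡A₁ᵀ : ∀ x y → A₂ x y ≡ A₁ y x
  A₂≡A₁ᵀ with transp (suc zero)
  ... | suc (suc zero) , A₂≡ = A₂≡
  ... | zero , A₀≡A₁ᵀ = contradiction (trans (sym (A₀≡A₁ᵀ x₀ x₀)) (trans (A₀≡I x₀ x₀) (I-refl m x₀)))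
                          (λ A₁x₀x₀ → true≢false (trans (sym A₁x₀x₀) (A₁-irreflexive x₀)))
  ... | suc zero , A₁-sym = contradiction all-symmetric (λ sym-all → proj₂ nonSym (sym-all (proj₁ nonSym)))
    where
    A₂-sym : ∀ x y → A₂ x y ≡ A₂ y x
    A₂-sym x y = b2n-injective (+-cancelˡ-≡ (b2n (I m x y) + b2n (A₁ x y)) _ _ (trans (partition x y)
      (sym (trans (cong₂ (λ d p → b2n d + b2n p + b2n (A₂ y x)) (I-sym m x y) (A₁-sym x y)) (partition y x)))))
    all-symmetric : ∀ i x y → A i x y ≡ A i y x
    all-symmetric zero             x y = trans (A₀≡I x y) (trans (I-sym m x y) (sym (A₀≡I y x)))
    all-symmetric (suc zero)       = A₁-sym
    all-symmetric (suc (suc zero)) = A₂-sym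

  tournament : IsTournament A₁
  tournament x y = trans (cong (λ b → b2n (I m x y) + b2n (A₁ x y) + b2n b) (sym (A₂≡A₁ᵀ x y))) (partition x y)

  open Tournament tournament

  expand : ∀ (c : Fin 3 → ℕ) x y → sumFin 3 (λ l → c l * b2n (A l x y)) ≡
           c zero * b2n (I m x y) + c (suc zero) * b2n (A₁ x y) + c (suc (suc zero)) * b2n (A₁ y x)
  expand c x y rewrite A₀≡I x y | A₂≡A₁ᵀ x y =
    sym (combination (c zero) (c (suc zero)) (c (suc (suc zero))) (b2n (I m x y)) (b2n (A₁ x y)) (b2n (A₁ y x)))

  expand-diagonal : ∀ (c : Fin 3 → ℕ) x → sumFin 3 (λ l → c l * b2n (A l x x)) ≡ c zero
  expand-diagonal c x rewrite expand c x x | I-refl m x | A₁-irreflexive x =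
    diagonal-term (c zero) (c (suc zero)) (c (suc (suc zero)))
    where
    diagonal-term : ∀ a b c → a * 1 + b * 0 + c * 0 ≡ a
    diagonal-term = solve-∀

  u₀ v₀ : Fin m
  u₀ = proj₁ (nonzero (suc zero))
  v₀ = proj₁ (proj₂ (nonzero (suc zero)))

  A₁u₀v₀ : A₁ u₀ v₀ ≡ true
  A₁u₀v₀ = proj₂ (proj₂ (nonzero (suc zero)))

  k-out k-in : ℕ
  k-out = proj₁ (product (suc zero) (suc (suc zero))) zero
  k-in  = proj₁ (product (suc (suc zero)) (suc zero)) zero

  outdeg≡k-out : ∀ x → outdeg A₁ x ≡ k-out
  outdeg≡k-out x = begin
    outdeg A₁ x
      ≡⟨ sum-cong m (λ z → sym (trans (cong (λ b → b2n (A₁ x z) * b2n b) (A₂≡A₁ᵀ z x)) (b2n-idem (A₁ x z)))) ⟩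
    prodEntry A₁ A₂ x x
      ≡⟨ proj₂ (product (suc zero) (suc (suc zero))) x x ⟩
    sumFin 3 (λ l → proj₁ (product (suc zero) (suc (suc zero))) l * b2n (A l x x))
      ≡⟨ expand-diagonal (proj₁ (product (suc zero) (suc (suc zero)))) x ⟩
    k-out ∎
    where open ≡-Reasoning

  indeg≡k-in : ∀ x → indeg A₁ x ≡ k-in
  indeg≡k-in x = begin
    indeg A₁ x
      ≡⟨ sum-cong m (λ z → sym (trans (cong (λ b → b2n b * b2n (A₁ z x)) (A₂≡A₁ᵀ x z)) (b2n-idem (A₁ z x)))) ⟩
    prodEntry A₂ A₁ x x
      ≡⟨ proj₂ (product (suc (suc zero)) (suc zero)) x x ⟩
    sumFin 3 (λ l → proj₁ (product (suc (suc zero)) (suc zero)) l * b2n (A l x x))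
      ≡⟨ expand-diagonal (proj₁ (product (suc (suc zero)) (suc zero))) x ⟩
    k-in ∎
    where open ≡-Reasoning

  k-out≡k-in : k-out ≡ k-in
  k-out≡k-in = *-cancelˡ-≡ k-out k-in m {{>-nonZero m>0}} (begin
    m * k-out                            ≡⟨ sym (sum-const m k-out) ⟩
    sumFin m (λ _ → k-out)               ≡⟨ sum-cong m (sym ∘ outdeg≡k-out) ⟩
    sumFin m (outdeg A₁)                 ≡⟨ sum-swap m m (λ x z → b2n (A₁ x z)) ⟩
    sumFin m (indeg A₁)                  ≡⟨ sum-cong m indeg≡k-in ⟩
    sumFin m (λ _ → k-in)                ≡⟨ sum-const m k-in ⟩
    m * k-in ∎)
    where
    open ≡-Reasoning
    m>0 : 0 < m
    m>0 = subst (0 <_) (sym (order-decomposition x₀)) (s≤s z≤n)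

  α : Fin 3 → ℕ
  α = proj₁ (product (suc zero) (suc zero))

  square≡α : ∀ x y → prodEntry A₁ A₁ x y ≡
             α zero * b2n (I m x y) + α (suc zero) * b2n (A₁ x y) + α (suc (suc zero)) * b2n (A₁ y x)
  square≡α x y = trans (proj₂ (product (suc zero) (suc zero)) x y) (expand α x y)

  α₀≡0 : α zero ≡ 0
  α₀≡0 = begin
    α zero                                          ≡⟨ sym (expand-diagonal α x₀) ⟩
    sumFin 3 (λ l → α l * b2n (A l x₀ x₀))          ≡⟨ sym (proj₂ (product (suc zero) (suc zero)) x₀ x₀) ⟩
    prodEntry A₁ A₁ x₀ x₀                           ≡⟨ square-diagonal x₀ ⟩
    0 ∎
    where open ≡-Reasoning

  square-arc : prodEntry A₁ A₁ u₀ v₀ ≡ α (suc zero)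
  square-arc rewrite square≡α u₀ v₀ | I-≢ m (arc⇒≢ A₁u₀v₀) | A₁u₀v₀ | asymmetric A₁u₀v₀ =
    middle (α zero) (α (suc zero)) (α (suc (suc zero)))
    where
    middle : ∀ a b c → a * 0 + b * 1 + c * 0 ≡ b
    middle = solve-∀

  square-reverse-arc : prodEntry A₁ A₁ v₀ u₀ ≡ α (suc (suc zero))
  square-reverse-arc rewrite square≡α v₀ u₀ | I-≢ m (arc⇒≢ A₁u₀v₀ ∘ sym) | A₁u₀v₀ | asymmetric A₁u₀v₀ =
    last (α zero) (α (suc zero)) (α (suc (suc zero)))
    where
    last : ∀ a b c → a * 0 + b * 0 + c * 1 ≡ c
    last = solve-∀

  -- Compare the out-degree decompositions along the arc u₀ → v₀ and its reverse.
  α₂≡1+α₁ : α (suc (suc zero)) ≡ suc (α (suc zero))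
  α₂≡1+α₁ = +-cancelʳ-≡ (prodEntry A₁ (transposeM A₁) v₀ u₀) _ _ (begin
    α (suc (suc zero)) + prodEntry A₁ (transposeM A₁) v₀ u₀
      ≡⟨ cong₂ (λ b P → b2n b + P + prodEntry A₁ (transposeM A₁) v₀ u₀) (sym (asymmetric A₁u₀v₀)) (sym square-reverse-arc) ⟩
    b2n (A₁ v₀ u₀) + prodEntry A₁ A₁ v₀ u₀ + prodEntry A₁ (transposeM A₁) v₀ u₀
      ≡⟨ trans (outdeg-decomposition v₀ u₀) (outdeg≡k-out v₀) ⟩
    k-out
      ≡⟨ sym (trans (outdeg-decomposition u₀ v₀) (outdeg≡k-out u₀)) ⟩
    b2n (A₁ u₀ v₀) + prodEntry A₁ A₁ u₀ v₀ + prodEntry A₁ (transposeM A₁) u₀ v₀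
      ≡⟨ cong₂ _+_ (cong₂ (λ b P → b2n b + P) A₁u₀v₀ square-arc) (sum-cong m λ z → *-comm (b2n (A₁ u₀ z)) _) ⟩
    suc (α (suc zero)) + prodEntry A₁ (transposeM A₁) v₀ u₀ ∎)
    where open ≡-Reasoning

  s : ℕ
  s = α (suc zero)

  square≡ : ∀ x y → prodEntry A₁ A₁ x y ≡ s * b2n (A₁ x y) + suc s * b2n (A₁ y x)
  square≡ x y = trans (square≡α x y)
    (cong₂ (λ a c → a * b2n (I m x y) + s * b2n (A₁ x y) + c * b2n (A₁ y x)) α₀≡0 α₂≡1+α₁)

  -- Count the 2-paths out of x₀ by their middle vertex and by their end vertex.
  k-out²≡ : k-out * k-out ≡ (s + suc s) * k-out
  k-out²≡ = begin
    k-out * k-out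
      ≡⟨ cong (k-out *_) (sym (outdeg≡k-out x₀)) ⟩
    k-out * outdeg A₁ x₀
      ≡⟨ sym (sum-*ˡ m k-out (λ z → b2n (A₁ x₀ z))) ⟩
    sumFin m (λ z → k-out * b2n (A₁ x₀ z))
      ≡⟨ sum-cong m (λ z → trans (*-comm k-out _) (cong (b2n (A₁ x₀ z) *_) (sym (outdeg≡k-out z)))) ⟩
    sumFin m (λ z → b2n (A₁ x₀ z) * outdeg A₁ z)
      ≡⟨ sum-cong m (λ z → sym (sum-*ˡ m (b2n (A₁ x₀ z)) (λ y → b2n (A₁ z y)))) ⟩
    sumFin m (λ z → sumFin m (λ y → b2n (A₁ x₀ z) * b2n (A₁ z y)))
      ≡⟨ sum-swap m m (λ z y → b2n (A₁ x₀ z) * b2n (A₁ z y)) ⟩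
    sumFin m (prodEntry A₁ A₁ x₀)
      ≡⟨ sum-cong m (square≡ x₀) ⟩
    sumFin m (λ y → s * b2n (A₁ x₀ y) + suc s * b2n (A₁ y x₀))
      ≡⟨ sum-+ m _ _ ⟩
    sumFin m (λ y → s * b2n (A₁ x₀ y)) + sumFin m (λ y → suc s * b2n (A₁ y x₀))
      ≡⟨ cong₂ _+_ (sum-*ˡ m s (λ y → b2n (A₁ x₀ y))) (sum-*ˡ m (suc s) (λ y → b2n (A₁ y x₀))) ⟩
    s * outdeg A₁ x₀ + suc s * indeg A₁ x₀
      ≡⟨ cong₂ (λ o i → s * o + suc s * i) (outdeg≡k-out x₀) (trans (indeg≡k-in x₀) (sym k-out≡k-in)) ⟩
    s * k-out + suc s * k-out
      ≡⟨ sym (*-distribʳ-+ k-out s (suc s)) ⟩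
    (s + suc s) * k-out ∎
    where open ≡-Reasoning

  k-out>0 : 0 < k-out
  k-out>0 = subst (0 <_) (trans (outdeg-decomposition u₀ v₀) (outdeg≡k-out u₀)) positive
    where
    positive : 0 < b2n (A₁ u₀ v₀) + prodEntry A₁ A₁ u₀ v₀ + prodEntry A₁ (transposeM A₁) u₀ v₀
    positive rewrite A₁u₀v₀ = s≤s z≤n

  k-out≡ : k-out ≡ s + suc s
  k-out≡ = *-cancelʳ-≡ k-out (s + suc s) k-out {{>-nonZero k-out>0}} k-out²≡

  doublyRegular : IsDoublyRegular A₁ s
  doublyRegular = record
    { tournament = tournament
    ; outdeg≡    = λ x → trans (outdeg≡k-out x) k-out≡
    ; indeg≡     = λ x → trans (indeg≡k-in x) (trans (sym k-out≡k-in) k-out≡)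
    ; square≡    = square≡
    }

-- Automorphisms

module _ {m d : ℕ} {A : Fin (suc d) → Mat m} {G : Permutation′ m → Set} (W : SchurianWitness A G) where
  open SchurianWitness W

  schurian-preserves : ∀ {σ} → G σ → ∀ i {u v} → A i u v ≡ true → A i (σ ⟨$⟩ʳ u) (σ ⟨$⟩ʳ v) ≡ true
  schurian-preserves {σ} Gσ i {u} {v} Auv with orbit i
  ... | x , y , _ , orbit≡ with Equivalence.to (orbit≡ u v) Auv
  ...   | τ , Gτ , τx≡u , τy≡v = Equivalence.from (orbit≡ (σ ⟨$⟩ʳ u) (σ ⟨$⟩ʳ v))
          (τ ∘ₚ σ , G-comp τ σ Gτ Gσ , cong (σ ⟨$⟩ʳ_) τx≡u , cong (σ ⟨$⟩ʳ_) τy≡v)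

  schurian-group⊆Aut : ∀ {σ} → G σ → IsAut A σ
  schurian-group⊆Aut {σ} Gσ i u v = ≡-from-true reflect (schurian-preserves Gσ i)
    where
    reflect : A i (σ ⟨$⟩ʳ u) (σ ⟨$⟩ʳ v) ≡ true → A i u v ≡ true
    reflect Aσuσv = subst₂ (λ x y → A i x y ≡ true) (inverseˡ σ) (inverseˡ σ)
                           (schurian-preserves (G-inv σ Gσ) i Aσuσv)

Schurian⇒AutTransitive : ∀ {m d} {A : Fin (suc d) → Mat m} → Schurian A → AutTransitive A
Schurian⇒AutTransitive (G , W) x y with SchurianWitness.G-trans W x y
... | σ , Gσ , σx≡y = σ , schurian-group⊆Aut W Gσ , σx≡y

IsAut-flip : ∀ {m d} {A : Fin (suc d) → Mat m} σ → IsAut A σ → IsAut A (flip σ)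
IsAut-flip {A = A} σ aut i u v =
  trans (sym (aut i (σ ⟨$⟩ˡ u) (σ ⟨$⟩ˡ v))) (cong₂ (A i) (inverseʳ σ) (inverseʳ σ))

HasTwins : {n : ℕ} → Mat n → Fin n → Set
HasTwins {n} T u = ∀ w → T w u ≡ true → ∃[ v ] (T u v ≡ true × (∀ t → T u t ≡ true → T v t ≡ T w t))

HasTwins-resp : ∀ {n} {T : Mat n} (σ : Permutation′ n) → (∀ u v → T (σ ⟨$⟩ʳ u) (σ ⟨$⟩ʳ v) ≡ T u v) →
                ∀ {u} → HasTwins T u → HasTwins T (σ ⟨$⟩ʳ u)
HasTwins-resp {T = T} σ σ-preserves {u} twins w Twσu with twins (σ ⟨$⟩ˡ w) Tw′u
  where
  Tw′u : T (σ ⟨$⟩ˡ w) u ≡ true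
  Tw′u = trans (sym (σ-preserves (σ ⟨$⟩ˡ w) u)) (subst (λ x → T x (σ ⟨$⟩ʳ u) ≡ true) (sym (inverseʳ σ)) Twσu)
... | v , Tuv , agree = σ ⟨$⟩ʳ v , trans (σ-preserves u v) Tuv , agree′
  where
  agree′ : ∀ t → T (σ ⟨$⟩ʳ u) t ≡ true → T (σ ⟨$⟩ʳ v) t ≡ T w t
  agree′ t Tσut = begin
    T (σ ⟨$⟩ʳ v) t                           ≡⟨ cong (T (σ ⟨$⟩ʳ v)) (sym (inverseʳ σ)) ⟩
    T (σ ⟨$⟩ʳ v) (σ ⟨$⟩ʳ (σ ⟨$⟩ˡ t))          ≡⟨ σ-preserves v (σ ⟨$⟩ˡ t) ⟩
    T v (σ ⟨$⟩ˡ t)                            ≡⟨ agree (σ ⟨$⟩ˡ t) Tut′ ⟩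
    T (σ ⟨$⟩ˡ w) (σ ⟨$⟩ˡ t)                   ≡⟨ sym (σ-preserves (σ ⟨$⟩ˡ w) (σ ⟨$⟩ˡ t)) ⟩
    T (σ ⟨$⟩ʳ (σ ⟨$⟩ˡ w)) (σ ⟨$⟩ʳ (σ ⟨$⟩ˡ t)) ≡⟨ cong₂ T (inverseʳ σ) (inverseʳ σ) ⟩
    T w t ∎
    where
    open ≡-Reasoning
    Tut′ : T u (σ ⟨$⟩ˡ t) ≡ true
    Tut′ = trans (sym (σ-preserves u (σ ⟨$⟩ˡ t))) (subst (λ x → T (σ ⟨$⟩ʳ u) x ≡ true) (sym (inverseʳ σ)) Tσut)

-- The doubled tournament

module Points (m : ℕ) where

  ι₁ : Fin m → Fin (m + suc m)
  ι₁ x = x ↑ˡ suc m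

  ∞ : Fin (m + suc m)
  ∞ = m ↑ʳ zero

  ι₂ : Fin m → Fin (m + suc m)
  ι₂ x = m ↑ʳ suc x

  data View : Fin (m + suc m) → Set where
    first  : ∀ x → View (ι₁ x)
    apex   : View ∞
    second : ∀ x → View (ι₂ x)

  view : ∀ u → View u
  view u with splitAt m u | join-splitAt m (suc m) u
  ... | inj₁ x       | eq = subst View eq (first x)
  ... | inj₂ zero    | eq = subst View eq apex
  ... | inj₂ (suc x) | eq = subst View eq (second x)

  splitAt-ι₁ : ∀ x → splitAt m (ι₁ x) ≡ inj₁ x
  splitAt-ι₁ x = splitAt-↑ˡ m x (suc m)

  splitAt-∞ : splitAt m ∞ ≡ inj₂ zero
  splitAt-∞ = splitAt-↑ʳ m (suc m) zero

  splitAt-ι₂ : ∀ x → splitAt m (ι₂ x) ≡ inj₂ (suc x)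
  splitAt-ι₂ x = splitAt-↑ʳ m (suc m) (suc x)

  ι₁-injective : ∀ {x y} → ι₁ x ≡ ι₁ y → x ≡ y
  ι₁-injective = ↑ˡ-injective (suc m) _ _

  ι₂-injective : ∀ {x y} → ι₂ x ≡ ι₂ y → x ≡ y
  ι₂-injective = suc-injective ∘ ↑ʳ-injective m _ _

  ι₁≢∞ : ∀ x → ¬ ι₁ x ≡ ∞
  ι₁≢∞ x eq with trans (sym (splitAt-ι₁ x)) (trans (cong (splitAt m) eq) splitAt-∞)
  ... | ()

  ι₂≢∞ : ∀ x → ¬ ι₂ x ≡ ∞
  ι₂≢∞ x eq with trans (sym (splitAt-ι₂ x)) (trans (cong (splitAt m) eq) splitAt-∞)
  ... | ()

  ι₁≢ι₂ : ∀ x y → ¬ ι₁ x ≡ ι₂ y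
  ι₁≢ι₂ x y eq with trans (sym (splitAt-ι₁ x)) (trans (cong (splitAt m) eq) (splitAt-ι₂ y))
  ... | ()

  sum-blocks : ∀ (f : Fin (m + suc m) → ℕ) →
               sumFin (m + suc m) f ≡ sumFin m (f ∘ ι₁) + (f ∞ + sumFin m (f ∘ ι₂))
  sum-blocks = sum-↑ m (suc m)

  module Blocks (a a₂ : Mat m) where

    B : Mat (m + suc m)
    B = B₁ a a₂

    B₁₁ : ∀ x y → B (ι₁ x) (ι₁ y) ≡ a x y
    B₁₁ x y rewrite splitAt-ι₁ x | splitAt-ι₁ y = refl
    B₁∞ : ∀ x → B (ι₁ x) ∞ ≡ false
    B₁∞ x rewrite splitAt-ι₁ x | splitAt-∞ = refl
    B₁₂ : ∀ x y → B (ι₁ x) (ι₂ y) ≡ I m x y ∨ a x y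
    B₁₂ x y rewrite splitAt-ι₁ x | splitAt-ι₂ y = refl
    B∞₁ : ∀ y → B ∞ (ι₁ y) ≡ true
    B∞₁ y rewrite splitAt-∞ | splitAt-ι₁ y = refl
    B∞∞ : B ∞ ∞ ≡ false
    B∞∞ rewrite splitAt-∞ = refl
    B∞₂ : ∀ y → B ∞ (ι₂ y) ≡ false
    B∞₂ y rewrite splitAt-∞ | splitAt-ι₂ y = refl
    B₂₁ : ∀ x y → B (ι₂ x) (ι₁ y) ≡ a x y
    B₂₁ x y rewrite splitAt-ι₂ x | splitAt-ι₁ y = refl
    B₂∞ : ∀ x → B (ι₂ x) ∞ ≡ true
    B₂∞ x rewrite splitAt-ι₂ x | splitAt-∞ = refl
    B₂₂ : ∀ x y → B (ι₂ x) (ι₂ y) ≡ a₂ x y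
    B₂₂ x y rewrite splitAt-ι₂ x | splitAt-ι₂ y = refl

module Doubling {m : ℕ} (A : Fin 3 → Mat m) (A₂≡A₁ᵀ : ∀ x y → A (suc (suc zero)) x y ≡ A (suc zero) y x)
                {s : ℕ} (dr : IsDoublyRegular (A (suc zero)) s) (x₀ : Fin m) where
  open Points m
  open Blocks (A (suc zero)) (A (suc (suc zero)))
  open DoublyRegular dr

  a : Mat m
  a = A (suc zero)

  k : ℕ
  k = s + suc s

  B₂₂′ : ∀ x y → B (ι₂ x) (ι₂ y) ≡ a y x
  B₂₂′ x y = trans (B₂₂ x y) (A₂≡A₁ᵀ x y)

  I-ι₁ : ∀ x y → I (m + suc m) (ι₁ x) (ι₁ y) ≡ I m x y
  I-ι₁ = I-injective m (m + suc m) ι₁ ι₁-injective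

  I-ι₂ : ∀ x y → I (m + suc m) (ι₂ x) (ι₂ y) ≡ I m x y
  I-ι₂ = I-injective m (m + suc m) ι₂ ι₂-injective

  B-tournament : IsTournament B
  B-tournament u v with view u | view v
  ... | first x  | first y  rewrite I-ι₁ x y | B₁₁ x y | B₁₁ y x = tournament x y
  ... | first x  | apex     rewrite I-≢ (m + suc m) (ι₁≢∞ x) | B₁∞ x | B∞₁ x = refl
  ... | first x  | second y rewrite I-≢ (m + suc m) (ι₁≢ι₂ x y) | B₁₂ x y | B₂₁ y x =
    trans (cong (_+ b2n (a y x)) (b2n-I∨T x y)) (tournament x y)
  ... | apex     | first y  rewrite I-≢ (m + suc m) (ι₁≢∞ y ∘ sym) | B∞₁ y | B₁∞ y = refl
  ... | apex     | apex     rewrite I-refl (m + suc m) ∞ | B∞∞ = refl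
  ... | apex     | second y rewrite I-≢ (m + suc m) (ι₂≢∞ y ∘ sym) | B∞₂ y | B₂∞ y = refl
  ... | second x | first y  rewrite I-≢ (m + suc m) (ι₁≢ι₂ y x ∘ sym) | B₂₁ x y | B₁₂ y x =
    trans (cong (b2n (a x y) +_) (b2n-I∨T y x)) (trans (+-comm (b2n (a x y)) _) (tournament y x))
  ... | second x | apex     rewrite I-≢ (m + suc m) (ι₂≢∞ x) | B₂∞ x | B∞₂ x = refl
  ... | second x | second y rewrite I-ι₂ x y | B₂₂′ x y | B₂₂′ y x =
    trans (xy∙z≈xz∙y (b2n (I m x y)) _ _) (tournament x y)

  m≡ : m ≡ k + suc k
  m≡ = trans (order≡ x₀) (sym (+-suc k k))

  B-outdeg : ∀ u → outdeg B u ≡ k + suc k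
  B-outdeg u with view u
  ... | first x = trans (sum-blocks _)
    (cong₂ _+_ (trans (sum-cong m (cong b2n ∘ B₁₁ x)) (outdeg≡ x))
               (cong₂ _+_ (cong b2n (B₁∞ x)) (trans (sum-cong m (cong b2n ∘ B₁₂ x)) (trans (sum-I∨T-row x) (cong suc (outdeg≡ x))))))
  ... | apex = trans (sum-blocks _) (trans
    (cong₂ _+_ (trans (sum-cong m (cong b2n ∘ B∞₁)) (trans (sum-const m 1) (*-identityʳ m)))
               (cong₂ _+_ (cong b2n B∞∞) (trans (sum-cong m (cong b2n ∘ B∞₂)) (sum-zero m))))
    (trans (+-identityʳ m) m≡))
  ... | second x = trans (sum-blocks _)
    (cong₂ _+_ (trans (sum-cong m (cong b2n ∘ B₂₁ x)) (outdeg≡ x))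
               (cong₂ _+_ (cong b2n (B₂∞ x)) (trans (sum-cong m (cong b2n ∘ B₂₂′ x)) (indeg≡ x))))

  B-indeg : ∀ v → indeg B v ≡ k + suc k
  B-indeg v with view v
  ... | first y = trans (sum-blocks _)
    (cong₂ _+_ (trans (sum-cong m (λ z → cong b2n (B₁₁ z y))) (indeg≡ y))
               (cong₂ _+_ (cong b2n (B∞₁ y)) (trans (sum-cong m (λ z → cong b2n (B₂₁ z y))) (indeg≡ y))))
  ... | apex = trans (sum-blocks _) (trans
    (cong₂ _+_ (trans (sum-cong m (cong b2n ∘ B₁∞)) (sum-zero m))
               (cong₂ _+_ (cong b2n B∞∞) (trans (sum-cong m (cong b2n ∘ B₂∞)) (trans (sum-const m 1) (*-identityʳ m)))))
    m≡)
  ... | second y = trans (sum-blocks _) (trans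
    (cong₂ _+_ (trans (sum-cong m (λ z → cong b2n (B₁₂ z y))) (trans (sum-I∨T-column y) (cong suc (indeg≡ y))))
               (cong₂ _+_ (cong b2n (B∞₂ y)) (trans (sum-cong m (λ z → cong b2n (B₂₂′ z y))) (outdeg≡ y))))
    (+-comm (suc k) k))

  sum-*0 : ∀ (f : Fin m → ℕ) → sumFin m (λ z → f z * 0) ≡ 0
  sum-*0 f = trans (sum-cong m (*-zeroʳ ∘ f)) (sum-zero m)

  sum-*1 : ∀ (f : Fin m → ℕ) → sumFin m (λ z → f z * 1) ≡ sumFin m f
  sum-*1 f = sum-cong m (*-identityʳ ∘ f)

  sum-1* : ∀ (f : Fin m → ℕ) → sumFin m (λ z → 1 * f z) ≡ sumFin m f
  sum-1* f = sum-cong m (*-identityˡ ∘ f)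

  -- B² is split according to the block of the middle point; each of the nine cases then reduces
  -- to an identity between linear forms in I x y, a x y and a y x.
  square-blocks : ∀ {u v X Y Z} →
    sumFin m (λ z → b2n (B u (ι₁ z)) * b2n (B (ι₁ z) v)) ≡ X →
    b2n (B u ∞) * b2n (B ∞ v) ≡ Y →
    sumFin m (λ z → b2n (B u (ι₂ z)) * b2n (B (ι₂ z) v)) ≡ Z →
    prodEntry B B u v ≡ X + (Y + Z)
  square-blocks e₁ e∞ e₂ = trans (sum-blocks _) (cong₂ _+_ e₁ (cong₂ _+_ e∞ e₂))

  square-target : ∀ {u v b c} → B u v ≡ b → B v u ≡ c →
           k * b2n b + suc k * b2n c ≡ k * b2n (B u v) + suc k * b2n (B v u)
  square-target Buv Bvu = sym (cong₂ (λ b c → k * b2n b + suc k * b2n c) Buv Bvu)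

  SquareFormula : Fin (m + suc m) → Fin (m + suc m) → Set
  SquareFormula u v = prodEntry B B u v ≡ k * b2n (B u v) + suc k * b2n (B v u)

  square₁₁ : ∀ x y → SquareFormula (ι₁ x) (ι₁ y)
  square₁₁ x y = trans
    (square-blocks (trans (sum-cong m λ z → b2n*-cong (B₁₁ x z) (B₁₁ z y)) (square≡ x y))
                   (b2n*-cong (B₁∞ x) (B∞₁ y))
                   (trans (sum-cong m λ z → b2n*-cong (B₁₂ x z) (B₂₁ z y))
                          (trans (sum-I∨Tˡ x (λ z → b2n (a z y))) (cong (b2n (a x y) +_) (square≡ x y)))))
    (trans (arith s (b2n (a x y)) (b2n (a y x))) (square-target (B₁₁ x y) (B₁₁ y x)))
    where
    arith : ∀ s p q → (s * p + suc s * q) + (0 + (p + (s * p + suc s * q))) ≡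
                      (s + suc s) * p + suc (s + suc s) * q
    arith = solve-∀

  square₁∞ : ∀ x → SquareFormula (ι₁ x) ∞
  square₁∞ x = trans
    (square-blocks (trans (sum-cong m λ z → b2n*-cong (B₁₁ x z) (B₁∞ z)) (sum-*0 (b2n ∘ a x)))
                   (b2n*-cong (B₁∞ x) B∞∞)
                   (trans (sum-cong m λ z → b2n*-cong (B₁₂ x z) (B₂∞ z))
                          (trans (sum-*1 _) (trans (sum-I∨T-row x) (cong suc (outdeg≡ x))))))
    (trans (arith k) (square-target (B₁∞ x) (B∞₁ x)))
    where
    arith : ∀ k → 0 + (0 + suc k) ≡ k * 0 + suc k * 1
    arith = solve-∀

  square₁₂ : ∀ x y → SquareFormula (ι₁ x) (ι₂ y)
  square₁₂ x y = trans
    (square-blocks (trans (sum-cong m λ z → b2n*-cong (B₁₁ x z) (B₁₂ z y))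
                          (trans (sum-I∨Tʳ y (b2n ∘ a x)) (cong (b2n (a x y) +_) (square≡ x y))))
                   (b2n*-cong (B₁∞ x) (B∞₂ y))
                   (trans (sum-cong m λ z → b2n*-cong (B₁₂ x z) (B₂₂′ z y))
                          (trans (sum-I∨Tˡ x (λ z → b2n (a y z))) (cong (b2n (a y x) +_) (TTᵀ≡ x y)))))
    (trans (arith s (b2n (I m x y)) (b2n (a x y)) (b2n (a y x)))
           (trans (cong (λ d → k * d + suc k * b2n (a y x)) (sym (b2n-I∨T x y))) (square-target (B₁₂ x y) (B₂₁ y x))))
    where
    arith : ∀ s d p q → (p + (s * p + suc s * q)) + (0 + (q + ((s + suc s) * d + s * p + s * q))) ≡
                        (s + suc s) * (d + p) + suc (s + suc s) * q
    arith = solve-∀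

  square∞₁ : ∀ y → SquareFormula ∞ (ι₁ y)
  square∞₁ y = trans
    (square-blocks (trans (sum-cong m λ z → b2n*-cong (B∞₁ z) (B₁₁ z y)) (trans (sum-1* _) (indeg≡ y)))
                   (b2n*-cong B∞∞ (B∞₁ y))
                   (trans (sum-cong m λ z → b2n*-cong (B∞₂ z) (B₂₁ z y)) (sum-zero m)))
    (trans (arith k) (square-target (B∞₁ y) (B₁∞ y)))
    where
    arith : ∀ k → k + (0 + 0) ≡ k * 1 + suc k * 0
    arith = solve-∀

  square∞∞ : SquareFormula ∞ ∞
  square∞∞ = trans
    (square-blocks (trans (sum-cong m λ z → b2n*-cong (B∞₁ z) (B₁∞ z)) (sum-zero m))
                   (b2n*-cong B∞∞ B∞∞)
                   (trans (sum-cong m λ z → b2n*-cong (B∞₂ z) (B₂∞ z)) (sum-zero m)))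
    (trans (arith k) (square-target B∞∞ B∞∞))
    where
    arith : ∀ k → 0 + (0 + 0) ≡ k * 0 + suc k * 0
    arith = solve-∀

  square∞₂ : ∀ y → SquareFormula ∞ (ι₂ y)
  square∞₂ y = trans
    (square-blocks (trans (sum-cong m λ z → b2n*-cong (B∞₁ z) (B₁₂ z y))
                          (trans (sum-1* _) (trans (sum-I∨T-column y) (cong suc (indeg≡ y)))))
                   (b2n*-cong B∞∞ (B∞₂ y))
                   (trans (sum-cong m λ z → b2n*-cong (B∞₂ z) (B₂₂ z y)) (sum-zero m)))
    (trans (arith k) (square-target (B∞₂ y) (B₂∞ y)))
    where
    arith : ∀ k → suc k + (0 + 0) ≡ k * 0 + suc k * 1
    arith = solve-∀

  square₂₁ : ∀ x y → SquareFormula (ι₂ x) (ι₁ y)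
  square₂₁ x y = trans
    (square-blocks (trans (sum-cong m λ z → b2n*-cong (B₂₁ x z) (B₁₁ z y)) (square≡ x y))
                   (b2n*-cong (B₂∞ x) (B∞₁ y))
                   (trans (sum-cong m λ z → b2n*-cong (B₂₂′ x z) (B₂₁ z y)) (TᵀT≡ x y)))
    (trans (arith s (b2n (I m x y)) (b2n (a x y)) (b2n (a y x)) (tournament x y))
           (trans (cong (λ d → k * b2n (a x y) + suc k * (d + b2n (a y x))) (cong b2n (I-sym m x y)))
                  (trans (cong (λ d → k * b2n (a x y) + suc k * d) (sym (b2n-I∨T y x)))
                         (square-target (B₂₁ x y) (B₁₂ y x)))))
    where
    arith : ∀ s d p q → d + p + q ≡ 1 →
            (s * p + suc s * q) + (1 + ((s + suc s) * d + s * p + s * q)) ≡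
            (s + suc s) * p + suc (s + suc s) * (d + q)
    arith s d p q one = trans (cong (λ o → (s * p + suc s * q) + (o + ((s + suc s) * d + s * p + s * q))) (sym one))
                              (expand s d p q)
      where
      expand : ∀ s d p q → (s * p + suc s * q) + ((d + p + q) + ((s + suc s) * d + s * p + s * q)) ≡
                           (s + suc s) * p + suc (s + suc s) * (d + q)
      expand = solve-∀

  square₂∞ : ∀ x → SquareFormula (ι₂ x) ∞
  square₂∞ x = trans
    (square-blocks (trans (sum-cong m λ z → b2n*-cong (B₂₁ x z) (B₁∞ z)) (sum-*0 (b2n ∘ a x)))
                   (b2n*-cong (B₂∞ x) B∞∞)
                   (trans (sum-cong m λ z → b2n*-cong (B₂₂′ x z) (B₂∞ z)) (trans (sum-*1 _) (indeg≡ x))))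
    (trans (arith k) (square-target (B₂∞ x) (B∞₂ x)))
    where
    arith : ∀ k → 0 + (0 + k) ≡ k * 1 + suc k * 0
    arith = solve-∀

  square₂₂ : ∀ x y → SquareFormula (ι₂ x) (ι₂ y)
  square₂₂ x y = trans
    (square-blocks (trans (sum-cong m λ z → b2n*-cong (B₂₁ x z) (B₁₂ z y))
                          (trans (sum-I∨Tʳ y (b2n ∘ a x)) (cong (b2n (a x y) +_) (square≡ x y))))
                   (b2n*-cong (B₂∞ x) (B∞₂ y))
                   (trans (sum-cong m λ z → trans (b2n*-cong (B₂₂′ x z) (B₂₂′ z y)) (*-comm (b2n (a z x)) _))
                          (square≡ y x)))
    (trans (arith s (b2n (a x y)) (b2n (a y x))) (square-target (B₂₂′ x y) (B₂₂′ y x)))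
    where
    arith : ∀ s p q → (p + (s * p + suc s * q)) + (0 + (s * q + suc s * p)) ≡
                      (s + suc s) * q + suc (s + suc s) * p
    arith = solve-∀

  B-square : ∀ u v → SquareFormula u v
  B-square u v with view u | view v
  ... | first x  | first y  = square₁₁ x y
  ... | first x  | apex     = square₁∞ x
  ... | first x  | second y = square₁₂ x y
  ... | apex     | first y  = square∞₁ y
  ... | apex     | apex     = square∞∞
  ... | apex     | second y = square∞₂ y
  ... | second x | first y  = square₂₁ x y
  ... | second x | apex     = square₂∞ x
  ... | second x | second y = square₂₂ x y

  B-doublyRegular : IsDoublyRegular B k
  B-doublyRegular = record
    { tournament = B-tournament
    ; outdeg≡    = B-outdeg
    ; indeg≡     = B-indeg
    ; square≡    = B-square
    }

  𝔜-isAssocScheme : IsAssocScheme (m + suc m) 2 (𝔜 A)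
  𝔜-isAssocScheme = IsAssocScheme-resp tournamentScheme≗𝔜 (DoublyRegular.isAssocScheme B-doublyRegular ∞)
    where
    tournamentScheme≗𝔜 : ∀ i u v → tournamentScheme B i u v ≡ 𝔜 A i u v
    tournamentScheme≗𝔜 zero             u v = refl
    tournamentScheme≗𝔜 (suc zero)       u v = refl
    tournamentScheme≗𝔜 (suc (suc zero)) u v = refl

  𝔜-nonSymmetric : NonSymmetric (𝔜 A)
  𝔜-nonSymmetric = suc zero , λ symmetric → true≢false (trans (sym (B∞₁ x₀)) (trans (symmetric ∞ (ι₁ x₀)) (B₁∞ x₀)))

-- Automorphisms of the doubled tournament

module DoublingAutomorphisms {m : ℕ} (A : Fin 3 → Mat m) (A₀≡I : ∀ x y → A zero x y ≡ I m x y)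
  (A₂≡A₁ᵀ : ∀ x y → A (suc (suc zero)) x y ≡ A (suc zero) y x)
  {s : ℕ} (dr : IsDoublyRegular (A (suc zero)) s) (x₀ : Fin m) (1≤s : 1 ≤ s) where

  open Points m
  open Blocks (A (suc zero)) (A (suc (suc zero)))
  open DoublyRegular dr
  open Doubling A A₂≡A₁ᵀ dr x₀ using (a; B₂₂′)

  apex-has-twins : HasTwins B ∞
  apex-has-twins w Bw∞ with view w
  ... | first x  = contradiction (trans (sym Bw∞) (B₁∞ x)) true≢false
  ... | apex     = contradiction (trans (sym Bw∞) B∞∞) true≢false
  ... | second x = ι₁ x , B∞₁ x , agree
    where
    agree : ∀ t → B ∞ t ≡ true → B (ι₁ x) t ≡ B (ι₂ x) t
    agree t B∞t with view t
    ... | first y  = trans (B₁₁ x y) (sym (B₂₁ x y))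
    ... | apex     = contradiction (trans (sym B∞t) B∞∞) true≢false
    ... | second y = contradiction (trans (sym B∞t) (B∞₂ y)) true≢false

  first-lacks-twins : ∀ x → ¬ HasTwins B (ι₁ x)
  first-lacks-twins x twins with in-neighbour x
  ... | z , azx with twins (ι₁ z) (trans (B₁₁ z x) azx)
  ... | v , x→v , agree = excluded (view v)
    where
    v→ι₂x : B v (ι₂ x) ≡ true
    v→ι₂x = trans (agree (ι₂ x) (trans (B₁₂ x x) (cong (_∨ a x x) (I-refl m x))))
                  (trans (B₁₂ z x) (trans (cong (I m z x ∨_) azx) (∨-zeroʳ (I m z x))))

    excluded : View v → ⊥
    excluded (first y) = true≢false (trans (sym v→ι₂x) (trans (B₁₂ y x)
                           (cong₂ _∨_ (I-≢ m (arc⇒≢ axy ∘ sym)) (asymmetric axy))))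
      where
      axy : a x y ≡ true
      axy = trans (sym (B₁₁ x y)) x→v
    excluded apex = true≢false (trans (sym x→v) (B₁∞ x))
    -- Take a 2-path x → q → y; as z ≠ q, the twin condition at ι₁ q and ι₂ q forces a q y ≡ a y q.
    excluded (second y) with two-path 1≤s (trans (sym (B₂₂′ y x)) v→ι₂x)
    ... | q , axq , aqy = arcs-differ (arc⇒≢ aqy) (begin
      a q y                 ≡⟨ trans (sym (B₂₂′ y q)) (agree (ι₂ q) x→ι₂q) ⟩
      B (ι₁ z) (ι₂ q)       ≡⟨ trans (B₁₂ z q) (cong (_∨ a z q) (I-≢ m z≢q)) ⟩
      a z q                 ≡⟨ trans (sym (B₁₁ z q)) (sym (agree (ι₁ q) (trans (B₁₁ x q) axq))) ⟩
      B (ι₂ y) (ι₁ q)       ≡⟨ B₂₁ y q ⟩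
      a y q ∎)
      where
      open ≡-Reasoning
      x→ι₂q : B (ι₁ x) (ι₂ q) ≡ true
      x→ι₂q = trans (B₁₂ x q) (trans (cong (I m x q ∨_) axq) (∨-zeroʳ (I m x q)))
      z≢q : ¬ z ≡ q
      z≢q refl = true≢false (trans (sym axq) (asymmetric azx))

  second-lacks-twins : ∀ x → ¬ HasTwins B (ι₂ x)
  second-lacks-twins x twins with out-neighbour x
  ... | z , axz with twins (ι₂ z) (trans (B₂₂′ z x) axz)
  ... | v , x→v , agree = excluded (view v)
    where
    v→∞ : B v ∞ ≡ true
    v→∞ = trans (agree ∞ (B₂∞ x)) (B₂∞ z)

    excluded : View v → ⊥
    excluded (first y) = true≢false (trans (sym v→∞) (B₁∞ y))
    excluded apex      = true≢false (trans (sym v→∞) B∞∞)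
    excluded (second y) = same-arcs-around-arc 1≤s (trans (sym (B₂₂′ x y)) x→v) axz agree-out agree-in
      where
      agree-out : ∀ q → a x q ≡ true → a y q ≡ a z q
      agree-out q axq = trans (sym (B₂₁ y q)) (trans (agree (ι₁ q) (trans (B₂₁ x q) axq)) (B₂₁ z q))
      agree-in : ∀ q → a q x ≡ true → a q y ≡ a q z
      agree-in q aqx = trans (sym (B₂₂′ y q)) (trans (agree (ι₂ q) (trans (B₂₂′ x q) aqx)) (B₂₂′ z q))

  has-twins⇒apex : ∀ u → HasTwins B u → u ≡ ∞
  has-twins⇒apex u twins with view u
  ... | first x  = contradiction twins (first-lacks-twins x)
  ... | apex     = refl
  ... | second x = contradiction twins (second-lacks-twins x)

  apex-fixed : ∀ σ → IsAut (𝔜 A) σ → σ ⟨$⟩ʳ ∞ ≡ ∞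
  apex-fixed σ aut = has-twins⇒apex (σ ⟨$⟩ʳ ∞) (HasTwins-resp σ (aut (suc zero)) apex-has-twins)

  restrict : Permutation′ (m + suc m) → Fin m → Fin m
  restrict σ x = fromInj₁ (λ _ → x) (splitAt m (σ ⟨$⟩ʳ ι₁ x))

  apex-out-neighbour : ∀ u (d : Fin m) → B ∞ u ≡ true → u ≡ ι₁ (fromInj₁ (λ _ → d) (splitAt m u))
  apex-out-neighbour u d B∞u with view u
  ... | first y  rewrite splitAt-ι₁ y = refl
  ... | apex     = contradiction (trans (sym B∞u) B∞∞) true≢false
  ... | second y = contradiction (trans (sym B∞u) (B∞₂ y)) true≢false

  σ-ι₁ : ∀ σ → IsAut (𝔜 A) σ → ∀ x → σ ⟨$⟩ʳ ι₁ x ≡ ι₁ (restrict σ x)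
  σ-ι₁ σ aut x = apex-out-neighbour (σ ⟨$⟩ʳ ι₁ x) x
    (trans (cong (λ c → B c (σ ⟨$⟩ʳ ι₁ x)) (sym (apex-fixed σ aut))) (trans (aut (suc zero) ∞ (ι₁ x)) (B∞₁ x)))

  restrict-inverseʳ : ∀ σ → IsAut (𝔜 A) σ → ∀ y → restrict σ (restrict (flip σ) y) ≡ y
  restrict-inverseʳ σ aut y = ι₁-injective (begin
    ι₁ (restrict σ (restrict (flip σ) y)) ≡⟨ sym (σ-ι₁ σ aut (restrict (flip σ) y)) ⟩
    σ ⟨$⟩ʳ ι₁ (restrict (flip σ) y)       ≡⟨ cong (σ ⟨$⟩ʳ_) (sym (σ-ι₁ (flip σ) (IsAut-flip σ aut) y)) ⟩
    σ ⟨$⟩ʳ (σ ⟨$⟩ˡ ι₁ y)                  ≡⟨ inverseʳ σ ⟩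
    ι₁ y ∎)
    where open ≡-Reasoning

  restrict-inverseˡ : ∀ σ → IsAut (𝔜 A) σ → ∀ x → restrict (flip σ) (restrict σ x) ≡ x
  restrict-inverseˡ σ aut x = ι₁-injective (begin
    ι₁ (restrict (flip σ) (restrict σ x)) ≡⟨ sym (σ-ι₁ (flip σ) (IsAut-flip σ aut) (restrict σ x)) ⟩
    σ ⟨$⟩ˡ ι₁ (restrict σ x)              ≡⟨ cong (σ ⟨$⟩ˡ_) (sym (σ-ι₁ σ aut x)) ⟩
    σ ⟨$⟩ˡ (σ ⟨$⟩ʳ ι₁ x)                  ≡⟨ inverseˡ σ ⟩
    ι₁ x ∎)
    where open ≡-Reasoning

  restrict-preserves : ∀ σ → IsAut (𝔜 A) σ → ∀ x y → a (restrict σ x) (restrict σ y) ≡ a x y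
  restrict-preserves σ aut x y = begin
    a (restrict σ x) (restrict σ y)        ≡⟨ sym (B₁₁ _ _) ⟩
    B (ι₁ (restrict σ x)) (ι₁ (restrict σ y)) ≡⟨ sym (cong₂ B (σ-ι₁ σ aut x) (σ-ι₁ σ aut y)) ⟩
    B (σ ⟨$⟩ʳ ι₁ x) (σ ⟨$⟩ʳ ι₁ y)          ≡⟨ aut (suc zero) (ι₁ x) (ι₁ y) ⟩
    B (ι₁ x) (ι₁ y)                        ≡⟨ B₁₁ x y ⟩
    a x y ∎
    where open ≡-Reasoning

  apex-in-neighbour : ∀ {u} → B u ∞ ≡ true → ∃[ w ] (u ≡ ι₂ w)
  apex-in-neighbour {u} Bu∞ with view u
  ... | first y  = contradiction (trans (sym Bu∞) (B₁∞ y)) true≢false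
  ... | apex     = contradiction (trans (sym Bu∞) B∞∞) true≢false
  ... | second y = y , refl

  σ-ι₂ : ∀ σ → IsAut (𝔜 A) σ → ∀ x → σ ⟨$⟩ʳ ι₂ x ≡ ι₂ (restrict σ x)
  σ-ι₂ σ aut x with apex-in-neighbour {σ ⟨$⟩ʳ ι₂ x}
      (trans (cong (B (σ ⟨$⟩ʳ ι₂ x)) (sym (apex-fixed σ aut))) (trans (aut (suc zero) (ι₂ x) ∞) (B₂∞ x)))
  ... | w , σι₂x≡ι₂w = trans σι₂x≡ι₂w (cong ι₂ (row-injective rows))
    where
    rows : ∀ t → a w t ≡ a (restrict σ x) t
    rows t = begin
      a w t                                  ≡⟨ cong (a w) (sym (restrict-inverseʳ σ aut t)) ⟩
      a w (restrict σ t′)                    ≡⟨ sym (B₂₁ w (restrict σ t′)) ⟩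
      B (ι₂ w) (ι₁ (restrict σ t′))          ≡⟨ sym (cong₂ B σι₂x≡ι₂w (σ-ι₁ σ aut t′)) ⟩
      B (σ ⟨$⟩ʳ ι₂ x) (σ ⟨$⟩ʳ ι₁ t′)         ≡⟨ aut (suc zero) (ι₂ x) (ι₁ t′) ⟩
      B (ι₂ x) (ι₁ t′)                       ≡⟨ B₂₁ x t′ ⟩
      a x t′                                 ≡⟨ sym (restrict-preserves σ aut x t′) ⟩
      a (restrict σ x) (restrict σ t′)       ≡⟨ cong (a (restrict σ x)) (restrict-inverseʳ σ aut t) ⟩
      a (restrict σ x) t ∎
      where
      open ≡-Reasoning
      t′ : Fin m
      t′ = restrict (flip σ) t

  restrictPerm : ∀ σ → IsAut (𝔜 A) σ → Permutation′ m
  restrictPerm σ aut = permutation (restrict σ) (restrict (flip σ)) (restrict-inverseʳ σ aut) (restrict-inverseˡ σ aut)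

  restrict-aut : ∀ σ (aut : IsAut (𝔜 A) σ) → IsAut A (restrictPerm σ aut)
  restrict-aut σ aut zero x y = trans (A₀≡I _ _) (trans (I-injective m m (restrict σ) injective x y) (sym (A₀≡I x y)))
    where
    injective : ∀ {x y} → restrict σ x ≡ restrict σ y → x ≡ y
    injective {x} {y} eq = trans (sym (restrict-inverseˡ σ aut x))
                                 (trans (cong (restrict (flip σ)) eq) (restrict-inverseˡ σ aut y))
  restrict-aut σ aut (suc zero) x y = restrict-preserves σ aut x y
  restrict-aut σ aut (suc (suc zero)) x y =
    trans (A₂≡A₁ᵀ _ _) (trans (restrict-preserves σ aut y x) (sym (A₂≡A₁ᵀ x y)))

  extend : (Fin m → Fin m) → Fin (m + suc m) → Fin (m + suc m)
  extend f u with splitAt m u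
  ... | inj₁ x       = ι₁ (f x)
  ... | inj₂ zero    = ∞
  ... | inj₂ (suc x) = ι₂ (f x)

  extend-ι₁ : ∀ f x → extend f (ι₁ x) ≡ ι₁ (f x)
  extend-ι₁ f x rewrite splitAt-ι₁ x = refl

  extend-∞ : ∀ f → extend f ∞ ≡ ∞
  extend-∞ f rewrite splitAt-∞ = refl

  extend-ι₂ : ∀ f x → extend f (ι₂ x) ≡ ι₂ (f x)
  extend-ι₂ f x rewrite splitAt-ι₂ x = refl

  extend-cong : ∀ {f g} → (∀ x → f x ≡ g x) → ∀ u → extend f u ≡ extend g u
  extend-cong f≗g u with splitAt m u
  ... | inj₁ x       = cong ι₁ (f≗g x)
  ... | inj₂ zero    = refl
  ... | inj₂ (suc x) = cong ι₂ (f≗g x)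

  extend-inverse : ∀ {f g} → (∀ x → f (g x) ≡ x) → ∀ u → extend f (extend g u) ≡ u
  extend-inverse {f} {g} fg≗id u with view u
  ... | first x  = trans (cong (extend f) (extend-ι₁ g x)) (trans (extend-ι₁ f (g x)) (cong ι₁ (fg≗id x)))
  ... | apex     = trans (cong (extend f) (extend-∞ g)) (extend-∞ f)
  ... | second x = trans (cong (extend f) (extend-ι₂ g x)) (trans (extend-ι₂ f (g x)) (cong ι₂ (fg≗id x)))

  extendPerm : Permutation′ m → Permutation′ (m + suc m)
  extendPerm τ = permutation (extend (τ ⟨$⟩ʳ_)) (extend (τ ⟨$⟩ˡ_))
                             (extend-inverse (λ _ → inverseʳ τ)) (extend-inverse (λ _ → inverseˡ τ))

  extend-preserves-B : ∀ f → (∀ i x y → A i (f x) (f y) ≡ A i x y) →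
                       ∀ u v → B (extend f u) (extend f v) ≡ B u v
  extend-preserves-B f aut u v with view u | view v
  ... | first x  | first y  rewrite extend-ι₁ f x | extend-ι₁ f y | B₁₁ (f x) (f y) | B₁₁ x y = aut (suc zero) x y
  ... | first x  | apex     rewrite extend-ι₁ f x | extend-∞ f | B₁∞ (f x) | B₁∞ x = refl
  ... | first x  | second y rewrite extend-ι₁ f x | extend-ι₂ f y | B₁₂ (f x) (f y) | B₁₂ x y =
    cong₂ _∨_ (trans (sym (A₀≡I (f x) (f y))) (trans (aut zero x y) (A₀≡I x y))) (aut (suc zero) x y)
  ... | apex     | first y  rewrite extend-∞ f | extend-ι₁ f y | B∞₁ (f y) | B∞₁ y = refl
  ... | apex     | apex     rewrite extend-∞ f = refl
  ... | apex     | second y rewrite extend-∞ f | extend-ι₂ f y | B∞₂ (f y) | B∞₂ y = refl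
  ... | second x | first y  rewrite extend-ι₂ f x | extend-ι₁ f y | B₂₁ (f x) (f y) | B₂₁ x y = aut (suc zero) x y
  ... | second x | apex     rewrite extend-ι₂ f x | extend-∞ f | B₂∞ (f x) | B₂∞ x = refl
  ... | second x | second y rewrite extend-ι₂ f x | extend-ι₂ f y | B₂₂ (f x) (f y) | B₂₂ x y = aut (suc (suc zero)) x y

  extend-aut : ∀ τ → IsAut A τ → IsAut (𝔜 A) (extendPerm τ)
  extend-aut τ aut zero u v = I-injective (m + suc m) (m + suc m) (extend (τ ⟨$⟩ʳ_)) injective u v
    where
    injective : ∀ {u v} → extend (τ ⟨$⟩ʳ_) u ≡ extend (τ ⟨$⟩ʳ_) v → u ≡ v
    injective {u} {v} eq = trans (sym (extend-inverse (λ _ → inverseˡ τ) u))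
                                 (trans (cong (extend (τ ⟨$⟩ˡ_)) eq) (extend-inverse (λ _ → inverseˡ τ) v))
  extend-aut τ aut (suc zero)       u v = extend-preserves-B (τ ⟨$⟩ʳ_) aut u v
  extend-aut τ aut (suc (suc zero)) u v = extend-preserves-B (τ ⟨$⟩ʳ_) aut v u

  restrict-ι₁ : ∀ (d y : Fin m) → fromInj₁ (λ _ → d) (splitAt m (ι₁ y)) ≡ y
  restrict-ι₁ d y = cong (fromInj₁ (λ _ → d)) (splitAt-ι₁ y)

  restrict-∘ : ∀ σ σ′ → IsAut (𝔜 A) σ → IsAut (𝔜 A) σ′ → ∀ x → restrict (σ ∘ₚ σ′) x ≡ restrict σ′ (restrict σ x)
  restrict-∘ σ σ′ aut aut′ x = begin
    fromInj₁ (λ _ → x) (splitAt m (σ′ ⟨$⟩ʳ (σ ⟨$⟩ʳ ι₁ x)))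
      ≡⟨ cong (λ u → fromInj₁ (λ _ → x) (splitAt m (σ′ ⟨$⟩ʳ u))) (σ-ι₁ σ aut x) ⟩
    fromInj₁ (λ _ → x) (splitAt m (σ′ ⟨$⟩ʳ ι₁ (restrict σ x)))
      ≡⟨ cong (λ u → fromInj₁ (λ _ → x) (splitAt m u)) (σ-ι₁ σ′ aut′ (restrict σ x)) ⟩
    fromInj₁ (λ _ → x) (splitAt m (ι₁ (restrict σ′ (restrict σ x))))
      ≡⟨ restrict-ι₁ x _ ⟩
    restrict σ′ (restrict σ x) ∎
    where open ≡-Reasoning

  extend-restrict : ∀ σ → IsAut (𝔜 A) σ → ∀ u → extend (restrict σ) u ≡ σ ⟨$⟩ʳ u
  extend-restrict σ aut u with view u
  ... | first x  = trans (extend-ι₁ (restrict σ) x) (sym (σ-ι₁ σ aut x))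
  ... | apex     = trans (extend-∞ (restrict σ)) (sym (apex-fixed σ aut))
  ... | second x = trans (extend-ι₂ (restrict σ) x) (sym (σ-ι₂ σ aut x))

  autIso : AutIso (𝔜 A) A
  autIso = record
    { to        = λ (σ , aut) → restrictPerm σ aut , restrict-aut σ aut
    ; from      = λ (τ , aut) → extendPerm τ , extend-aut τ aut
    ; to-cong   = λ _ _ σ≈σ′ x → cong (λ u → fromInj₁ (λ _ → x) (splitAt m u)) (σ≈σ′ (ι₁ x))
    ; from-cong = λ _ _ τ≈τ′ → extend-cong τ≈τ′
    ; to-from   = λ (τ , _) x → trans (cong (λ u → fromInj₁ (λ _ → x) (splitAt m u)) (extend-ι₁ (τ ⟨$⟩ʳ_) x))
                                      (restrict-ι₁ x (τ ⟨$⟩ʳ x))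
    ; from-to   = λ (σ , aut) → extend-restrict σ aut
    ; to-hom    = λ (σ , aut) (σ′ , aut′) → restrict-∘ σ σ′ aut aut′
    }

  ¬autTransitive : ¬ AutTransitive (𝔜 A)
  ¬autTransitive transitive with transitive ∞ (ι₁ x₀)
  ... | σ , aut , σ∞≡ι₁x₀ = ι₁≢∞ x₀ (trans (sym σ∞≡ι₁x₀) (apex-fixed σ aut))

theorem4 : (m : ℕ) → 7 ≤ m → (A : Fin 3 → Mat m) →
    IsAssocScheme m 2 A → NonSymmetric A →
    IsAssocScheme (m + suc m) 2 (𝔜 A) × NonSymmetric (𝔜 A) ×
    ¬ AutTransitive (𝔜 A) × ¬ Schurian (𝔜 A) × AutIso (𝔜 A) A
theorem4 m 7≤m A S nonSym =
  𝔜-isAssocScheme , 𝔜-nonSymmetric , ¬autTransitive , ¬autTransitive ∘ Schurian⇒AutTransitive , autIso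
  where
  open ClassTwo S nonSym using (A₂≡A₁ᵀ; doublyRegular; x₀)
  open Doubling A A₂≡A₁ᵀ doublyRegular x₀ using (𝔜-isAssocScheme; 𝔜-nonSymmetric)
  open DoublingAutomorphisms A (IsAssocScheme.A₀≡I S) A₂≡A₁ᵀ doublyRegular x₀
         (DoublyRegular.7≤order⇒1≤s doublyRegular x₀ 7≤m) using (¬autTransitive; autIso)
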